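{- Let $(G,\mathcal{C},\mathit{color})$ be an edge-colored graph (finite, simple, undirected) of order at least $m$, where $m$ is a positive integer, and let $f$ be a mapping from $\mathcal{C}$ to the set of non-negative integers. Then $G$ has an $f$-chromatic spanning forest with exactly $m$ components if and only if \[ \omega(G-E_R(G)) \le m+\sum_{c\in R} f(c) \quad \text{for every } R\subseteq \mathcal{C} \] (including $R=\emptyset$).
   Context: An edge-colored graph $(G,\mathcal{C},\mathit{color})$ is a finite simple undirected graph $G$ together with a map $\mathit{color}:E(G)\to\mathcal{C}$, where $\mathcal{C}$ is a set of colors. For $R\subseteq\mathcal{C}$, $E_R(G)=\{e\in E(G) : \mathit{color}(e)\in R\}$ and $E_c(G)=E_{\{c\}}(G)$; $G-E_R(G)$ denotes the graph $(V(G),E(G)\setminus E_R(G))$. $\omega(H)$ denotes the number of connected components of a graph $H$. Given a mapping $f$ from $\mathcal{C}$ to the non-negative integers, an edge-colored graph (or subgraph, with the inherited coloring) $H$ is $f$-chromatic if $|E_c(H)|\le f(c)$ for every color $c\in\mathcal{C}$. -}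

module Defs where

open import Data.Nat using (ℕ; zero; suc; _+_; _≤_)
open import Data.Bool using (Bool; true; false; _∧_; not; if_then_else_)
open import Data.Fin using (Fin; _<?_)
open import Data.Fin.Properties using (_≟_)
open import Data.Fin.Subset using (Subset; _∈_)
open import Data.Fin.Subset.Properties using (_∈?_)
open import Data.List using (List; []; _∷_; _++_; [_]; length; map; allFin)
open import Data.Nat.ListAction using (sum)
open import Data.List.Relation.Unary.Unique.Propositional using (Unique)
open import Data.Product using (Σ; _×_; ∃)
open import Relation.Binary.PropositionalEquality using (_≡_)
open import Relation.Nullary using (¬_)
open import Relation.Nullary.Decidable using (⌊_⌋)
open import Function.Definitions using (Surjective)
open import Function.Bundles using (_⇔_)

EdgeSet : ℕ → Set
EdgeSet n = Fin n → Fin n → Bool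

record ColoredGraph (n k : ℕ) : Set where
  field
    adj       : EdgeSet n
    adj-sym   : ∀ u v → adj u v ≡ adj v u
    adj-irr   : ∀ u → adj u u ≡ false
    color     : Fin n → Fin n → Fin k
    color-sym : ∀ u v → adj u v ≡ true → color u v ≡ color v u
open ColoredGraph public

data Reach {n : ℕ} (E : EdgeSet n) : Fin n → Fin n → Set where
  here : ∀ {u} → Reach E u u
  step : ∀ {u v w} → E u v ≡ true → Reach E v w → Reach E u w

-- (Fin n, E) has exactly j connected components: the vertices can be labelled
-- onto Fin j so that labels agree exactly on mutually reachable vertices.
HasComponents : {n : ℕ} → EdgeSet n → ℕ → Set
HasComponents {n} E j =
  Σ (Fin n → Fin j) λ comp →
    Surjective _≡_ _≡_ comp × (∀ u v → (comp u ≡ comp v) ⇔ Reach E u v)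

data IsWalk {n : ℕ} (E : EdgeSet n) : List (Fin n) → Set where
  nil  : IsWalk E []
  one  : ∀ {u} → IsWalk E (u ∷ [])
  cons : ∀ {u v vs} → E u v ≡ true → IsWalk E (v ∷ vs) → IsWalk E (u ∷ v ∷ vs)

Cycle : {n : ℕ} → EdgeSet n → Set
Cycle {n} E =
  Σ (Fin n) λ x → Σ (List (Fin n)) λ ys →
    (3 ≤ length (x ∷ ys)) × Unique (x ∷ ys) × IsWalk E (x ∷ ys ++ [ x ])

Acyclic : {n : ℕ} → EdgeSet n → Set
Acyclic E = ¬ Cycle E

-- number of edges {u,v} (counted once, u < v) of E having colour c
countColor : {n k : ℕ} → (Fin n → Fin n → Fin k) → EdgeSet n → Fin k → ℕ
countColor {n} col E c =
  sum (map (λ u → sum (map (λ v →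
        if ⌊ u <? v ⌋ ∧ E u v ∧ ⌊ col u v ≟ c ⌋ then 1 else 0) (allFin n))) (allFin n))

deleteColors : {n k : ℕ} → ColoredGraph n k → Subset k → EdgeSet n
deleteColors G R u v = adj G u v ∧ not ⌊ color G u v ∈? R ⌋

sumOver : {k : ℕ} → Subset k → (Fin k → ℕ) → ℕ
sumOver {k} R f = sum (map (λ c → if ⌊ c ∈? R ⌋ then f c else 0) (allFin k))

HasChromaticForest : {n k : ℕ} → ColoredGraph n k → (Fin k → ℕ) → ℕ → Set
HasChromaticForest {n} G f m =
  Σ (EdgeSet n) λ F →
    (∀ u v → F u v ≡ F v u) ×
    (∀ u v → F u v ≡ true → adj G u v ≡ true) ×
    Acyclic F ×
    HasComponents F m ×
    (∀ c → countColor (color G) F c ≤ f c)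

ComponentCondition : {n k : ℕ} → ColoredGraph n k → (Fin k → ℕ) → ℕ → Set
ComponentCondition {n} {k} G f m =
  ∀ (R : Subset k) (j : ℕ) → HasComponents (deleteColors G R) j → j ≤ m + sumOver R f

-- An f-chromatic spanning forest with m components is exactly a set of n ∸ m edges of G
-- independent both in the graphic matroid (rank n ∸ ω) and in the partition matroid allowing f c edges
-- of colour c. If F is such a forest, then G − E_R(G) contains F − E_R(G), whose number of components is
-- at most m + ∣F ∩ E_R(G)∣ ≤ m + ∑_{c ∈ R} f(c). Conversely, by the matroid intersection theorem such a
-- set exists once n ∸ m ≤ r₁(U) + r₂(E(G) ∖ U) for every U ⊆ E(G); taking for R the colours saturated
-- by E(G) ∖ U, this bound follows from the component condition for R. Matroid intersection itself is
-- proved by induction on the ground set S ∪ ⁅ s ⁆: if the bound already holds on S we recurse there,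
-- otherwise s is independent in both matroids and, by uncrossing, the bound holds after contracting s.

module Submission where

open import Defs

open import Data.Bool using (Bool; true; false; _∧_; _∨_; not; if_then_else_)
open import Data.Bool.Properties using (∨-idem; ∨-identityʳ; ∨-comm; ∧-idem; ∧-zeroʳ; ∧-assoc; ¬-not)
open import Data.Empty using () renaming (⊥ to Empty; ⊥-elim to Empty-elim)
open import Data.Fin using (Fin; zero; suc; _<?_; combine; remQuot; _↑ˡ_; _↑ʳ_; punchIn; punchOut)
  renaming (_<_ to _<ᶠ_)
open import Data.Fin.Properties
  using ( _≟_; <-cmp; <-asym; injective⇒≤; remQuot-combine; combine-remQuot
        ; combine-injectiveˡ; combine-injectiveʳ; punchOut-injective; punchOut-cong; punchInᵢ≢i
        ; punchOut-punchIn; ¬Fin0)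
open import Data.Fin.Subset
  using (Subset; ⊥; ∁; ⁅_⁆; _∪_; _∩_; _─_; _-_; ∣_∣; outside; inside; _∈_; _∉_; _⊆_)
open import Data.Fin.Subset.Properties
  using ( ∪-identityˡ; ∪-identityʳ; ∪-comm; ∪-assoc; ∪-abs-∩; ∪-inverseˡ; ∪-distribʳ-∩
        ; ∩-comm; ∩-zeroˡ; ∩-zeroʳ; ∩-identityʳ; ∩-distribˡ-∪; ∩-distribʳ-∪
        ; ∪-idempotentCommutativeMonoid; ∩-idempotentCommutativeMonoid
        ; p─⊥≡p; p─q─r≡p─q∪r; p─q⊆p; p⊆p∪q; q⊆p∪q; p∩q⊆p; ⊥⊆; ∉⊥; _⊆?_; anySubset?
        ; _∈?_; drop-there; x∈⁅x⁆; x∈⁅y⁆⇒x≡y; x∈p∪q⁺; x∈p∪q⁻; x∈p∩q⁺; x∈p∩q⁻; x∈∁p⇒x∉p; x∉p⇒x∈∁p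
        ; x∈p∧x∉q⇒x∈p─q; x∈p∧x≢y⇒x∈p-y; ∣⊥∣≡0; ∣⁅x⁆∣≡1; ∣p∩q∣≤∣p∣; ∣p∩q∣≤∣q∣; p⊆q⇒∣p∣≤∣q∣)
import Data.List as List
open import Data.List using ([]; _∷_; _++_; [_]; allFin)
open import Data.List.Properties using (map-tabulate)
open import Data.List.Relation.Unary.All as All using (All; []; _∷_)
open import Data.List.Relation.Unary.AllPairs using ([]; _∷_)
import Data.Nat as ℕ
open import Data.Nat using (ℕ; zero; suc; _+_; _*_; _∸_; _≤_; _<_; z≤n; s≤s; z<s; _⊓_; _≤?_)
open import Data.Nat.ListAction using () renaming (sum to sumᴸ)
open import Data.Nat.Properties hiding (_≟_; _<?_; <-cmp; <-asym)
open import Data.Product using (∃; _×_; _,_; proj₁; proj₂; swap)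
open import Data.Product.Properties using (,-injective)
import Data.Sum
open import Data.Sum using (_⊎_; inj₁; inj₂; [_,_]′)
open import Data.Vec using ([]; _∷_; lookup; tabulate; here; there)
open import Data.Vec.Properties using (lookup⇒[]=; []=⇒lookup; lookup-zipWith; lookup∘tabulate)
open import Function using (_∘_; id; case_of_)
open import Function.Bundles using (_⇔_; mk⇔; Equivalence)
open import Relation.Binary.Definitions using (tri<; tri≈; tri>)
open import Relation.Binary.PropositionalEquality hiding ([_])
open import Relation.Nullary using (¬_; Dec; yes; no)
open import Relation.Nullary.Decidable using (⌊_⌋; _×-dec_)

open import Algebra.Properties.CommutativeMonoid.Sum +-0-commutativeMonoid
  using (sum-syntax; sum-cong-≗; ∑-distrib-+; ∑-comm)
open import Algebra.Properties.CommutativeSemigroup +-commutativeSemigroup using (interchange)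

∧-true⁻ : ∀ x {y} → x ∧ y ≡ true → x ≡ true × y ≡ true
∧-true⁻ true y≡true = refl , y≡true

⌊⌋-true⁻ : ∀ {a} {A : Set a} (d : Dec A) → ⌊ d ⌋ ≡ true → A
⌊⌋-true⁻ (yes a) _ = a

⌊⌋-true⁺ : ∀ {a} {A : Set a} (d : Dec A) → A → ⌊ d ⌋ ≡ true
⌊⌋-true⁺ (yes _) _ = refl
⌊⌋-true⁺ (no ¬a) a = Empty-elim (¬a a)

∨-true⁻ : ∀ x {y} → x ∨ y ≡ true → x ≡ true ⊎ y ≡ true
∨-true⁻ true _ = inj₁ refl
∨-true⁻ false y≡true = inj₂ y≡true

∨-true⁺ˡ : ∀ {x} y → x ≡ true → x ∨ y ≡ true
∨-true⁺ˡ y refl = refl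

∨-true⁺ʳ : ∀ x {y} → y ≡ true → x ∨ y ≡ true
∨-true⁺ʳ true _ = refl
∨-true⁺ʳ false y≡true = y≡true

[m∸a]+[m∸b]≡[m+m]∸[a+b] : ∀ {m a b} → a ≤ m → b ≤ m → (m ∸ a) + (m ∸ b) ≡ (m + m) ∸ (a + b)
[m∸a]+[m∸b]≡[m+m]∸[a+b] {m} {a} {b} a≤m b≤m = begin
  (m ∸ a) + (m ∸ b) ≡⟨ +-∸-assoc (m ∸ a) b≤m ⟨
  (m ∸ a) + m ∸ b ≡⟨ cong (_∸ b) (+-∸-comm m a≤m) ⟨
  (m + m) ∸ a ∸ b ≡⟨ ∸-+-assoc (m + m) a b ⟩
  (m + m) ∸ (a + b) ∎
  where open ≡-Reasoning

m∸w≤1+m∸a : ∀ m {a w} → a ≤ suc w → m ∸ w ≤ suc (m ∸ a)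
m∸w≤1+m∸a m {a} {w} a≤1+w = m≤n+o⇒m∸n≤o m w (begin
  m ≤⟨ m≤n+m∸n m a ⟩
  a + (m ∸ a) ≤⟨ +-monoˡ-≤ (m ∸ a) a≤1+w ⟩
  suc w + (m ∸ a) ≡⟨ +-suc w (m ∸ a) ⟨
  w + suc (m ∸ a) ∎)
  where open ≤-Reasoning

m∸n≤[m∸a]+x : ∀ m {n a} x → a ≤ n + x → m ∸ n ≤ (m ∸ a) + x
m∸n≤[m∸a]+x m {n} {a} x a≤n+x = m≤n+o⇒m∸n≤o m n (begin
  m ≤⟨ m≤n+m∸n m a ⟩
  a + (m ∸ a) ≤⟨ +-monoˡ-≤ (m ∸ a) a≤n+x ⟩
  n + x + (m ∸ a) ≡⟨ +-assoc n x (m ∸ a) ⟩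
  n + (x + (m ∸ a)) ≡⟨ cong (n +_) (+-comm x (m ∸ a)) ⟩
  n + ((m ∸ a) + x) ∎)
  where open ≤-Reasoning

⊓-concave : ∀ f {u v p q} → u + v ≡ p + q → v ≤ p → v ≤ q → f ⊓ u + f ⊓ v ≤ f ⊓ p + f ⊓ q
⊓-concave f {u} {v} {p} {q} u+v≡p+q v≤p v≤q with ≤-total f p | ≤-total f q
... | inj₁ f≤p | _ = +-mono-≤ (subst (f ⊓ u ≤_) (sym (m≤n⇒m⊓n≡m f≤p)) (m⊓n≤m f u)) (⊓-monoʳ-≤ f v≤q)
... | inj₂ _ | inj₁ f≤q = subst (f ⊓ u + f ⊓ v ≤_) (+-comm (f ⊓ q) (f ⊓ p))
  (+-mono-≤ (subst (f ⊓ u ≤_) (sym (m≤n⇒m⊓n≡m f≤q)) (m⊓n≤m f u)) (⊓-monoʳ-≤ f v≤p))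
... | inj₂ p≤f | inj₂ q≤f = begin
  f ⊓ u + f ⊓ v ≤⟨ +-mono-≤ (m⊓n≤n f u) (m⊓n≤n f v) ⟩
  u + v ≡⟨ u+v≡p+q ⟩
  p + q ≡⟨ cong₂ _+_ (m≥n⇒m⊓n≡n p≤f) (m≥n⇒m⊓n≡n q≤f) ⟨
  f ⊓ p + f ⊓ q ∎
  where open ≤-Reasoning

f⊓[x+d]≤f⊓x+d : ∀ f x d → f ⊓ (x + d) ≤ f ⊓ x + d
f⊓[x+d]≤f⊓x+d f x d with ≤-total f x
... | inj₁ f≤x = ≤-trans (m⊓n≤m f (x + d)) (subst (_≤ f ⊓ x + d) (m≤n⇒m⊓n≡m f≤x) (m≤m+n (f ⊓ x) d))
... | inj₂ x≤f = subst (f ⊓ (x + d) ≤_) (cong (_+ d) (sym (m≥n⇒m⊓n≡n x≤f))) (m⊓n≤n f (x + d))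

⟦_⟧ : Bool → ℕ
⟦ b ⟧ = if b then 1 else 0

∑-mono-≤ : ∀ {N} {f g : Fin N → ℕ} → (∀ i → f i ≤ g i) → ∑[ i < N ] f i ≤ ∑[ i < N ] g i
∑-mono-≤ {zero} f≤g = z≤n
∑-mono-≤ {suc N} f≤g = +-mono-≤ (f≤g zero) (∑-mono-≤ (f≤g ∘ suc))

∑-zero : ∀ {N} {f : Fin N → ℕ} → (∀ i → f i ≡ 0) → ∑[ i < N ] f i ≡ 0
∑-zero {zero} f≡0 = refl
∑-zero {suc N} f≡0 = cong₂ _+_ (f≡0 zero) (∑-zero (f≡0 ∘ suc))

∑-≤-tight : ∀ {N} {f g : Fin N → ℕ} → (∀ i → f i ≤ g i) →
  ∑[ i < N ] f i ≡ ∑[ i < N ] g i → ∀ i → f i ≡ g i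
∑-≤-tight {suc N} {f} {g} f≤g ∑f≡∑g i with m≤n⇒m<n∨m≡n (f≤g zero)
... | inj₁ f₀<g₀ = Empty-elim (<-irrefl ∑f≡∑g (+-mono-<-≤ f₀<g₀ (∑-mono-≤ (f≤g ∘ suc))))
∑-≤-tight {suc N} {f} {g} f≤g ∑f≡∑g zero | inj₂ f₀≡g₀ = f₀≡g₀
∑-≤-tight {suc N} {f} {g} f≤g ∑f≡∑g (suc i) | inj₂ f₀≡g₀ =
  ∑-≤-tight (f≤g ∘ suc) (+-cancelˡ-≡ (g zero) _ _ (trans (cong (_+ _) (sym f₀≡g₀)) ∑f≡∑g)) i

∑-++ : ∀ a b (g : Fin (a + b) → ℕ) →
  ∑[ i < a + b ] g i ≡ ∑[ i < a ] g (i ↑ˡ b) + ∑[ j < b ] g (a ↑ʳ j)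
∑-++ zero b g = refl
∑-++ (suc a) b g = trans (cong (g zero +_) (∑-++ a b (g ∘ suc))) (sym (+-assoc (g zero) _ _))

∑-combine : ∀ a b (g : Fin (a * b) → ℕ) → ∑[ e < a * b ] g e ≡ ∑[ u < a ] ∑[ v < b ] g (combine u v)
∑-combine zero b g = refl
∑-combine (suc a) b g =
  trans (∑-++ b (a * b) g) (cong (∑[ v < b ] g (v ↑ˡ (a * b)) +_) (∑-combine a b (g ∘ (b ↑ʳ_))))

sum-map-allFin : ∀ k (g : Fin k → ℕ) → sumᴸ (List.map g (allFin k)) ≡ ∑[ i < k ] g i
sum-map-allFin k g = trans (cong sumᴸ (map-tabulate id g)) (sum-tabulate k g)
  where
  sum-tabulate : ∀ k (g : Fin k → ℕ) → sumᴸ (List.tabulate g) ≡ ∑[ i < k ] g i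
  sum-tabulate zero g = refl
  sum-tabulate (suc k) g = cong (g zero +_) (sum-tabulate k (g ∘ suc))

∑⟦x≟c⟧≡1 : ∀ {k} (x : Fin k) → ∑[ c < k ] ⟦ ⌊ x ≟ c ⌋ ⟧ ≡ 1
∑⟦x≟c⟧≡1 {suc k} zero = cong suc (∑-zero {k} (λ _ → refl))
∑⟦x≟c⟧≡1 {suc k} (suc x) = trans (sum-cong-≗ (cong ⟦_⟧ ∘ ⌊suc≟suc⌋)) (∑⟦x≟c⟧≡1 x)
  where
  ⌊suc≟suc⌋ : ∀ c → ⌊ suc x ≟ suc c ⌋ ≡ ⌊ x ≟ c ⌋
  ⌊suc≟suc⌋ c with x ≟ c
  ... | yes _ = refl
  ... | no _ = refl

∈-tabulate⁻ : ∀ {n} {g : Fin n → Bool} {i} → i ∈ tabulate g → g i ≡ true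
∈-tabulate⁻ {g = g} {i} i∈ = trans (sym (lookup∘tabulate g i)) ([]=⇒lookup i∈)

∈-tabulate⁺ : ∀ {n} {g : Fin n → Bool} {i} → g i ≡ true → i ∈ tabulate g
∈-tabulate⁺ {g = g} {i} gi = lookup⇒[]= i _ (trans (lookup∘tabulate g i) gi)

∣p∣≡∑ : ∀ {n} (p : Subset n) → ∣ p ∣ ≡ ∑[ i < n ] ⟦ lookup p i ⟧
∣p∣≡∑ [] = refl
∣p∣≡∑ (inside ∷ p) = cong suc (∣p∣≡∑ p)
∣p∣≡∑ (outside ∷ p) = ∣p∣≡∑ p

∪-lub : ∀ {n} {p q r : Subset n} → p ⊆ r → q ⊆ r → p ∪ q ⊆ r
∪-lub {p = p} {q} p⊆r q⊆r x∈p∪q = [ p⊆r , q⊆r ]′ (x∈p∪q⁻ p q x∈p∪q)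

∩-monoˡ-⊆ : ∀ {n} {p q : Subset n} r → p ⊆ q → p ∩ r ⊆ q ∩ r
∩-monoˡ-⊆ {p = p} r p⊆q x∈p∩r with x∈p∩q⁻ p r x∈p∩r
... | x∈p , x∈r = x∈p∩q⁺ (p⊆q x∈p , x∈r)

∪⁅⁆-induction : ∀ {ℓ n} (P : Subset n → Set ℓ) → P ⊥ →
  (∀ p x → x ∉ p → P p → P (p ∪ ⁅ x ⁆)) → ∀ p → P p
∪⁅⁆-induction P P⊥ add [] = P⊥
∪⁅⁆-induction P P⊥ add (outside ∷ p) =
  ∪⁅⁆-induction (P ∘ (outside ∷_)) P⊥ (λ q x x∉q → add (outside ∷ q) (suc x) (x∉q ∘ drop-there)) p
∪⁅⁆-induction P P⊥ add (inside ∷ p) =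
  ∪⁅⁆-induction (P ∘ (inside ∷_)) P⁅0⁆ (λ q x x∉q → add (inside ∷ q) (suc x) (x∉q ∘ drop-there)) p
  where
  P⁅0⁆ : P (inside ∷ ⊥)
  P⁅0⁆ = subst (λ q → P (inside ∷ q)) (∪-identityʳ ⊥) (add ⊥ zero (λ ()) P⊥)

∣p∪q∣+∣p∩q∣≡∣p∣+∣q∣ : ∀ {n} (p q : Subset n) → ∣ p ∪ q ∣ + ∣ p ∩ q ∣ ≡ ∣ p ∣ + ∣ q ∣
∣p∪q∣+∣p∩q∣≡∣p∣+∣q∣ [] [] = refl
∣p∪q∣+∣p∩q∣≡∣p∣+∣q∣ (outside ∷ p) (outside ∷ q) = ∣p∪q∣+∣p∩q∣≡∣p∣+∣q∣ p q
∣p∪q∣+∣p∩q∣≡∣p∣+∣q∣ (outside ∷ p) (inside ∷ q) =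
  trans (cong suc (∣p∪q∣+∣p∩q∣≡∣p∣+∣q∣ p q)) (sym (+-suc ∣ p ∣ ∣ q ∣))
∣p∪q∣+∣p∩q∣≡∣p∣+∣q∣ (inside ∷ p) (outside ∷ q) = cong suc (∣p∪q∣+∣p∩q∣≡∣p∣+∣q∣ p q)
∣p∪q∣+∣p∩q∣≡∣p∣+∣q∣ (inside ∷ p) (inside ∷ q) = cong suc (begin
  ∣ p ∪ q ∣ + suc ∣ p ∩ q ∣ ≡⟨ +-suc ∣ p ∪ q ∣ ∣ p ∩ q ∣ ⟩
  suc (∣ p ∪ q ∣ + ∣ p ∩ q ∣) ≡⟨ cong suc (∣p∪q∣+∣p∩q∣≡∣p∣+∣q∣ p q) ⟩
  suc (∣ p ∣ + ∣ q ∣) ≡⟨ +-suc ∣ p ∣ ∣ q ∣ ⟨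
  ∣ p ∣ + suc ∣ q ∣ ∎)
  where open ≡-Reasoning

x∉p⇒p∩⁅x⁆≡⊥ : ∀ {n} {x : Fin n} {p} → x ∉ p → p ∩ ⁅ x ⁆ ≡ ⊥
x∉p⇒p∩⁅x⁆≡⊥ {x = zero} {outside ∷ p} _ = cong (outside ∷_) (∩-zeroʳ p)
x∉p⇒p∩⁅x⁆≡⊥ {x = zero} {inside ∷ p} x∉p = Empty-elim (x∉p here)
x∉p⇒p∩⁅x⁆≡⊥ {x = suc x} {outside ∷ p} x∉p = cong (outside ∷_) (x∉p⇒p∩⁅x⁆≡⊥ (x∉p ∘ there))
x∉p⇒p∩⁅x⁆≡⊥ {x = suc x} {inside ∷ p} x∉p = cong (outside ∷_) (x∉p⇒p∩⁅x⁆≡⊥ (x∉p ∘ there))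

x∉p⇒∣p∪⁅x⁆∣≡1+∣p∣ : ∀ {n} {x : Fin n} {p} → x ∉ p → ∣ p ∪ ⁅ x ⁆ ∣ ≡ suc ∣ p ∣
x∉p⇒∣p∪⁅x⁆∣≡1+∣p∣ {n} {x} {p} x∉p = begin
  ∣ p ∪ ⁅ x ⁆ ∣ ≡⟨ +-identityʳ _ ⟨
  ∣ p ∪ ⁅ x ⁆ ∣ + 0 ≡⟨ cong (∣ p ∪ ⁅ x ⁆ ∣ +_) (∣⊥∣≡0 n) ⟨
  ∣ p ∪ ⁅ x ⁆ ∣ + ∣ ⊥ {n = n} ∣ ≡⟨ cong (λ q → ∣ p ∪ ⁅ x ⁆ ∣ + ∣ q ∣) (x∉p⇒p∩⁅x⁆≡⊥ x∉p) ⟨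
  ∣ p ∪ ⁅ x ⁆ ∣ + ∣ p ∩ ⁅ x ⁆ ∣ ≡⟨ ∣p∪q∣+∣p∩q∣≡∣p∣+∣q∣ p ⁅ x ⁆ ⟩
  ∣ p ∣ + ∣ ⁅ x ⁆ ∣ ≡⟨ cong (∣ p ∣ +_) (∣⁅x⁆∣≡1 x) ⟩
  ∣ p ∣ + 1 ≡⟨ +-comm ∣ p ∣ 1 ⟩
  suc ∣ p ∣ ∎
  where open ≡-Reasoning

∣p∪q∣≤∣p∣+∣q∣ : ∀ {n} (p q : Subset n) → ∣ p ∪ q ∣ ≤ ∣ p ∣ + ∣ q ∣
∣p∪q∣≤∣p∣+∣q∣ p q = subst (∣ p ∪ q ∣ ≤_) (∣p∪q∣+∣p∩q∣≡∣p∣+∣q∣ p q) (m≤m+n ∣ p ∪ q ∣ ∣ p ∩ q ∣)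

⊓∣∣-submodular : ∀ f {n} (p q : Subset n) → f ⊓ ∣ p ∪ q ∣ + f ⊓ ∣ p ∩ q ∣ ≤ f ⊓ ∣ p ∣ + f ⊓ ∣ q ∣
⊓∣∣-submodular f p q = ⊓-concave f (∣p∪q∣+∣p∩q∣≡∣p∣+∣q∣ p q) (∣p∩q∣≤∣p∣ p q) (∣p∩q∣≤∣q∣ p q)

x∉p⇒[p∪⁅x⁆]-x≡p : ∀ {n} {x : Fin n} {p} → x ∉ p → p ∪ ⁅ x ⁆ - x ≡ p
x∉p⇒[p∪⁅x⁆]-x≡p {x = zero} {outside ∷ p} _ =
  cong (outside ∷_) (trans (p─⊥≡p (p ∪ ⊥)) (∪-identityʳ p))
x∉p⇒[p∪⁅x⁆]-x≡p {x = zero} {inside ∷ p} x∉p = Empty-elim (x∉p here)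
x∉p⇒[p∪⁅x⁆]-x≡p {x = suc x} {outside ∷ p} x∉p = cong (outside ∷_) (x∉p⇒[p∪⁅x⁆]-x≡p (x∉p ∘ there))
x∉p⇒[p∪⁅x⁆]-x≡p {x = suc x} {inside ∷ p} x∉p = cong (inside ∷_) (x∉p⇒[p∪⁅x⁆]-x≡p (x∉p ∘ there))

x∈p⇒[p-x]∪⁅x⁆≡p : ∀ {n} {x : Fin n} {p} → x ∈ p → (p - x) ∪ ⁅ x ⁆ ≡ p
x∈p⇒[p-x]∪⁅x⁆≡p {x = zero} {inside ∷ p} here =
  cong (inside ∷_) (trans (cong (_∪ ⊥) (p─⊥≡p p)) (∪-identityʳ p))
x∈p⇒[p-x]∪⁅x⁆≡p {x = suc x} {outside ∷ p} (there x∈p) = cong (outside ∷_) (x∈p⇒[p-x]∪⁅x⁆≡p x∈p)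
x∈p⇒[p-x]∪⁅x⁆≡p {x = suc x} {inside ∷ p} (there x∈p) = cong (inside ∷_) (x∈p⇒[p-x]∪⁅x⁆≡p x∈p)

x∉p-x : ∀ {n} (p : Subset n) x → x ∉ p - x
x∉p-x (_ ∷ p) zero ()
x∉p-x (_ ∷ p) (suc x) (there x∈p-x) = x∉p-x p x x∈p-x

x∉q⇒[p∪⁅x⁆]─q≡[p─q]∪⁅x⁆ : ∀ {n} {x : Fin n} (p : Subset n) {q} → x ∉ q →
  p ∪ ⁅ x ⁆ ─ q ≡ (p ─ q) ∪ ⁅ x ⁆
x∉q⇒[p∪⁅x⁆]─q≡[p─q]∪⁅x⁆ {x = zero} (b ∷ p) {outside ∷ q} _ =
  cong ((b ∨ true) ∷_) (trans (cong (_─ q) (∪-identityʳ p)) (sym (∪-identityʳ (p ─ q))))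
x∉q⇒[p∪⁅x⁆]─q≡[p─q]∪⁅x⁆ {x = zero} (b ∷ p) {inside ∷ q} x∉q = Empty-elim (x∉q here)
x∉q⇒[p∪⁅x⁆]─q≡[p─q]∪⁅x⁆ {x = suc x} (b ∷ p) {outside ∷ q} x∉q =
  cong ((b ∨ false) ∷_) (x∉q⇒[p∪⁅x⁆]─q≡[p─q]∪⁅x⁆ p (x∉q ∘ there))
x∉q⇒[p∪⁅x⁆]─q≡[p─q]∪⁅x⁆ {x = suc x} (b ∷ p) {inside ∷ q} x∉q =
  cong (outside ∷_) (x∉q⇒[p∪⁅x⁆]─q≡[p─q]∪⁅x⁆ p (x∉q ∘ there))

p─q∪p─r≡p─q∩r : ∀ {n} (p q r : Subset n) → (p ─ q) ∪ (p ─ r) ≡ p ─ q ∩ r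
p─q∪p─r≡p─q∩r [] [] [] = refl
p─q∪p─r≡p─q∩r (x ∷ p) (outside ∷ q) (outside ∷ r) = cong₂ _∷_ (∨-idem x) (p─q∪p─r≡p─q∩r p q r)
p─q∪p─r≡p─q∩r (x ∷ p) (outside ∷ q) (inside ∷ r) = cong₂ _∷_ (∨-identityʳ x) (p─q∪p─r≡p─q∩r p q r)
p─q∪p─r≡p─q∩r (x ∷ p) (inside ∷ q) (outside ∷ r) = cong (x ∷_) (p─q∪p─r≡p─q∩r p q r)
p─q∪p─r≡p─q∩r (x ∷ p) (inside ∷ q) (inside ∷ r) = cong (outside ∷_) (p─q∪p─r≡p─q∩r p q r)

p─q∩p─r≡p─q∪r : ∀ {n} (p q r : Subset n) → (p ─ q) ∩ (p ─ r) ≡ p ─ q ∪ r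
p─q∩p─r≡p─q∪r [] [] [] = refl
p─q∩p─r≡p─q∪r (x ∷ p) (outside ∷ q) (outside ∷ r) = cong₂ _∷_ (∧-idem x) (p─q∩p─r≡p─q∪r p q r)
p─q∩p─r≡p─q∪r (x ∷ p) (outside ∷ q) (inside ∷ r) = cong₂ _∷_ (∧-zeroʳ x) (p─q∩p─r≡p─q∪r p q r)
p─q∩p─r≡p─q∪r (x ∷ p) (inside ∷ q) (outside ∷ r) = cong (outside ∷_) (p─q∩p─r≡p─q∪r p q r)
p─q∩p─r≡p─q∪r (x ∷ p) (inside ∷ q) (inside ∷ r) = cong (outside ∷_) (p─q∩p─r≡p─q∪r p q r)

x∉p⇒x∉q⇒[p∪⁅x⁆]─[q∪⁅x⁆]≡p─q : ∀ {n} {x : Fin n} {p q} → x ∉ p → x ∉ q →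
  p ∪ ⁅ x ⁆ ─ (q ∪ ⁅ x ⁆) ≡ p ─ q
x∉p⇒x∉q⇒[p∪⁅x⁆]─[q∪⁅x⁆]≡p─q {x = x} {p} {q} x∉p x∉q = begin
  p ∪ ⁅ x ⁆ ─ (q ∪ ⁅ x ⁆) ≡⟨ p─q─r≡p─q∪r (p ∪ ⁅ x ⁆) q ⁅ x ⁆ ⟨
  p ∪ ⁅ x ⁆ ─ q - x ≡⟨ cong (_- x) (x∉q⇒[p∪⁅x⁆]─q≡[p─q]∪⁅x⁆ p x∉q) ⟩
  (p ─ q) ∪ ⁅ x ⁆ - x ≡⟨ x∉p⇒[p∪⁅x⁆]-x≡p (x∉p ∘ p─q⊆p p q) ⟩
  p ─ q ∎
  where open ≡-Reasoning

-- Submodular rank functions and the matroid intersection theorem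

record SubmodularRank (n : ℕ) : Set where
  field
    rank : Subset n → ℕ
    submodular : ∀ p q → rank (p ∪ q) + rank (p ∩ q) ≤ rank p + rank q
    unit-increase : ∀ p x → rank (p ∪ ⁅ x ⁆) ≤ suc (rank p)
open SubmodularRank

module _ {n : ℕ} where
  open import Algebra.Solver.IdempotentCommutativeMonoid (∪-idempotentCommutativeMonoid n)

  infixl 5 _／_
  _／_ : SubmodularRank n → Fin n → SubmodularRank n
  rank (r ／ x) p = rank r (p ∪ ⁅ x ⁆)
  submodular (r ／ x) p q =
    subst₂ (λ a b → rank r a + rank r b ≤ rank r (p ∪ ⁅ x ⁆) + rank r (q ∪ ⁅ x ⁆))
    (solve 3 (λ p q x → (p ⊕ x) ⊕ (q ⊕ x) ⊜ (p ⊕ q) ⊕ x) refl p q ⁅ x ⁆)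
    (sym (∪-distribʳ-∩ ⁅ x ⁆ p q))
    (submodular r (p ∪ ⁅ x ⁆) (q ∪ ⁅ x ⁆))
  unit-increase (r ／ x) p y = subst (λ a → rank r a ≤ suc (rank r (p ∪ ⁅ x ⁆)))
    (solve 3 (λ p x y → (p ⊕ x) ⊕ y ⊜ (p ⊕ y) ⊕ x) refl p ⁅ x ⁆ ⁅ y ⁆)
    (unit-increase r (p ∪ ⁅ x ⁆) y)

module _ {n : ℕ} where

  RankSumBound : SubmodularRank n → SubmodularRank n → Subset n → ℕ → Set
  RankSumBound r₁ r₂ S K = ∀ U → U ⊆ S → K ≤ rank r₁ U + rank r₂ (S ─ U)

  RankSumViolation : SubmodularRank n → SubmodularRank n → Subset n → ℕ → Set
  RankSumViolation r₁ r₂ S K = ∃ λ U → U ⊆ S × rank r₁ U + rank r₂ (S ─ U) < K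

  rank-sum-bound? : ∀ r₁ r₂ S K → RankSumViolation r₁ r₂ S K ⊎ RankSumBound r₁ r₂ S K
  rank-sum-bound? r₁ r₂ S K with anySubset? (λ U → U ⊆? S ×-dec rank r₁ U + rank r₂ (S ─ U) ℕ.<? K)
  ... | yes violation = inj₁ violation
  ... | no ∄violation = inj₂ (λ U U⊆S → ≮⇒≥ (λ <K → ∄violation (U , U⊆S , <K)))

  -- Ranks are counted from the base value b = rank ⊥, which contraction raises.
  CommonIndependent : SubmodularRank n → SubmodularRank n → Subset n → ℕ → ℕ → Set
  CommonIndependent r₁ r₂ S b k =
    ∃ λ I → I ⊆ S × ∣ I ∣ ≡ k × rank r₁ I ≡ k + b × rank r₂ I ≡ k + b

  rank-∪-loop : ∀ (r : SubmodularRank n) {p x} → x ∉ p → rank r ⁅ x ⁆ ≤ rank r ⊥ →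
    rank r (p ∪ ⁅ x ⁆) ≤ rank r p
  rank-∪-loop r {p} {x} x∉p loop = +-cancelʳ-≤ (rank r ⊥) _ _ (begin
    rank r (p ∪ ⁅ x ⁆) + rank r ⊥
      ≡⟨ cong (λ q → rank r (p ∪ ⁅ x ⁆) + rank r q) (x∉p⇒p∩⁅x⁆≡⊥ x∉p) ⟨
    rank r (p ∪ ⁅ x ⁆) + rank r (p ∩ ⁅ x ⁆) ≤⟨ submodular r p ⁅ x ⁆ ⟩
    rank r p + rank r ⁅ x ⁆ ≤⟨ +-monoʳ-≤ (rank r p) loop ⟩
    rank r p + rank r ⊥ ∎)
    where open ≤-Reasoning

  rank-／-⊥ : ∀ (r : SubmodularRank n) {x b} → rank r ⊥ ≡ b → ¬ rank r ⁅ x ⁆ ≤ b →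
    rank (r ／ x) ⊥ ≡ suc b
  rank-／-⊥ r {x} refl not-loop = ≤-antisym (unit-increase r ⊥ x)
    (≰⇒> (not-loop ∘ subst (λ p → rank r p ≤ rank r ⊥) (∪-identityˡ ⁅ x ⁆)))

  -- A set U₀ ⊆ S violating the bound for S, while the bound holds for S ∪ ⁅ s ⁆, forces s to be
  -- independent in both matroids and the bound to hold again after contracting s.
  module Violation (r₁ r₂ : SubmodularRank n) (S : Subset n) (s : Fin n) (s∉S : s ∉ S) (b k : ℕ)
    (r₁⊥ : rank r₁ ⊥ ≡ b) (r₂⊥ : rank r₂ ⊥ ≡ b) (bound : RankSumBound r₁ r₂ (S ∪ ⁅ s ⁆) (b + b + suc k))
    (U₀ : Subset n) (U₀⊆S : U₀ ⊆ S) (U₀-violates : rank r₁ U₀ + rank r₂ (S ─ U₀) < b + b + suc k) where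

    K = b + b + suc k

    2+b+b+k≡1+K : suc b + suc b + k ≡ suc K
    2+b+b+k≡1+K = cong suc (trans (cong (_+ k) (+-suc b b)) (sym (+-suc (b + b) k)))

    s∉U₀ : s ∉ U₀
    s∉U₀ = s∉S ∘ U₀⊆S

    S∪⁅s⁆─U₀ : S ∪ ⁅ s ⁆ ─ U₀ ≡ (S ─ U₀) ∪ ⁅ s ⁆
    S∪⁅s⁆─U₀ = x∉q⇒[p∪⁅x⁆]─q≡[p─q]∪⁅x⁆ S s∉U₀

    rank₁-／s : rank (r₁ ／ s) ⊥ ≡ suc b
    rank₁-／s = rank-／-⊥ r₁ r₁⊥ λ loop → <-irrefl refl (begin-strict
      K ≤⟨ bound (U₀ ∪ ⁅ s ⁆) (∪-lub (p⊆p∪q ⁅ s ⁆ ∘ U₀⊆S) (q⊆p∪q S ⁅ s ⁆)) ⟩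
      rank r₁ (U₀ ∪ ⁅ s ⁆) + rank r₂ (S ∪ ⁅ s ⁆ ─ (U₀ ∪ ⁅ s ⁆))
        ≡⟨ cong (λ p → rank r₁ (U₀ ∪ ⁅ s ⁆) + rank r₂ p) (x∉p⇒x∉q⇒[p∪⁅x⁆]─[q∪⁅x⁆]≡p─q s∉S s∉U₀) ⟩
      rank r₁ (U₀ ∪ ⁅ s ⁆) + rank r₂ (S ─ U₀)
        ≤⟨ +-monoˡ-≤ _ (rank-∪-loop r₁ s∉U₀ (subst (rank r₁ ⁅ s ⁆ ≤_) (sym r₁⊥) loop)) ⟩
      rank r₁ U₀ + rank r₂ (S ─ U₀) <⟨ U₀-violates ⟩
      K ∎)
      where open ≤-Reasoning

    rank₂-／s : rank (r₂ ／ s) ⊥ ≡ suc b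
    rank₂-／s = rank-／-⊥ r₂ r₂⊥ λ loop → <-irrefl refl (begin-strict
      K ≤⟨ bound U₀ (p⊆p∪q ⁅ s ⁆ ∘ U₀⊆S) ⟩
      rank r₁ U₀ + rank r₂ (S ∪ ⁅ s ⁆ ─ U₀) ≡⟨ cong (λ p → rank r₁ U₀ + rank r₂ p) S∪⁅s⁆─U₀ ⟩
      rank r₁ U₀ + rank r₂ ((S ─ U₀) ∪ ⁅ s ⁆)
        ≤⟨ +-monoʳ-≤ _ (rank-∪-loop r₂ (s∉S ∘ p─q⊆p S U₀) (subst (rank r₂ ⁅ s ⁆ ≤_) (sym r₂⊥) loop)) ⟩
      rank r₁ U₀ + rank r₂ (S ─ U₀) <⟨ U₀-violates ⟩
      K ∎)
      where open ≤-Reasoning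

    -- Uncrossing U₀ with a violator W₀ of the contracted bound via U₀ ∪ W₀ ∪ ⁅ s ⁆ and U₀ ∩ W₀.
    module Uncrossing (W₀ : Subset n) (W₀⊆S : W₀ ⊆ S) where
      U₁ = (U₀ ∪ W₀) ∪ ⁅ s ⁆
      U₂ = U₀ ∩ W₀
      s∉W₀ = s∉S ∘ W₀⊆S
      U₁⊆ : U₁ ⊆ S ∪ ⁅ s ⁆
      U₁⊆ = ∪-lub (∪-lub (p⊆p∪q ⁅ s ⁆ ∘ U₀⊆S) (p⊆p∪q ⁅ s ⁆ ∘ W₀⊆S)) (q⊆p∪q S ⁅ s ⁆)
      U₂⊆ : U₂ ⊆ S ∪ ⁅ s ⁆
      U₂⊆ = p⊆p∪q ⁅ s ⁆ ∘ U₀⊆S ∘ p∩q⊆p U₀ W₀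
      U₀∩[W₀∪⁅s⁆] : U₀ ∩ (W₀ ∪ ⁅ s ⁆) ≡ U₂
      U₀∩[W₀∪⁅s⁆] = begin
        U₀ ∩ (W₀ ∪ ⁅ s ⁆) ≡⟨ ∩-distribˡ-∪ U₀ W₀ ⁅ s ⁆ ⟩
        U₂ ∪ (U₀ ∩ ⁅ s ⁆) ≡⟨ cong (U₂ ∪_) (x∉p⇒p∩⁅x⁆≡⊥ s∉U₀) ⟩
        U₂ ∪ ⊥ ≡⟨ ∪-identityʳ U₂ ⟩
        U₂ ∎
        where open ≡-Reasoning
      submodular₁ : rank r₁ U₁ + rank r₁ U₂ ≤ rank r₁ U₀ + rank r₁ (W₀ ∪ ⁅ s ⁆)
      submodular₁ = subst₂ (λ p q → rank r₁ p + rank r₁ q ≤ rank r₁ U₀ + rank r₁ (W₀ ∪ ⁅ s ⁆))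
        (sym (∪-assoc U₀ W₀ ⁅ s ⁆)) U₀∩[W₀∪⁅s⁆] (submodular r₁ U₀ (W₀ ∪ ⁅ s ⁆))
      ∪-side : (S ─ U₀) ∪ ((S ─ W₀) ∪ ⁅ s ⁆) ≡ S ∪ ⁅ s ⁆ ─ U₂
      ∪-side = begin
        (S ─ U₀) ∪ ((S ─ W₀) ∪ ⁅ s ⁆) ≡⟨ ∪-assoc (S ─ U₀) (S ─ W₀) ⁅ s ⁆ ⟨
        ((S ─ U₀) ∪ (S ─ W₀)) ∪ ⁅ s ⁆ ≡⟨ cong (_∪ ⁅ s ⁆) (p─q∪p─r≡p─q∩r S U₀ W₀) ⟩
        (S ─ U₂) ∪ ⁅ s ⁆ ≡⟨ x∉q⇒[p∪⁅x⁆]─q≡[p─q]∪⁅x⁆ S (s∉U₀ ∘ p∩q⊆p U₀ W₀) ⟨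
        S ∪ ⁅ s ⁆ ─ U₂ ∎
        where open ≡-Reasoning
      ∩-side : (S ─ U₀) ∩ ((S ─ W₀) ∪ ⁅ s ⁆) ≡ S ∪ ⁅ s ⁆ ─ U₁
      ∩-side = begin
        (S ─ U₀) ∩ ((S ─ W₀) ∪ ⁅ s ⁆) ≡⟨ ∩-distribˡ-∪ (S ─ U₀) (S ─ W₀) ⁅ s ⁆ ⟩
        ((S ─ U₀) ∩ (S ─ W₀)) ∪ ((S ─ U₀) ∩ ⁅ s ⁆)
          ≡⟨ cong₂ _∪_ (p─q∩p─r≡p─q∪r S U₀ W₀) (x∉p⇒p∩⁅x⁆≡⊥ (s∉S ∘ p─q⊆p S U₀)) ⟩
        (S ─ U₀ ∪ W₀) ∪ ⊥ ≡⟨ ∪-identityʳ _ ⟩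
        S ─ U₀ ∪ W₀ ≡⟨ x∉p⇒x∉q⇒[p∪⁅x⁆]─[q∪⁅x⁆]≡p─q s∉S ([ s∉U₀ , s∉W₀ ]′ ∘ x∈p∪q⁻ U₀ W₀) ⟨
        S ∪ ⁅ s ⁆ ─ U₁ ∎
        where open ≡-Reasoning
      submodular₂ : rank r₂ (S ∪ ⁅ s ⁆ ─ U₁) + rank r₂ (S ∪ ⁅ s ⁆ ─ U₂) ≤
                    rank r₂ (S ─ U₀) + rank r₂ ((S ─ W₀) ∪ ⁅ s ⁆)
      submodular₂ = subst₂ (λ p q → q + p ≤ rank r₂ (S ─ U₀) + rank r₂ ((S ─ W₀) ∪ ⁅ s ⁆))
        (cong (rank r₂) ∪-side) (cong (rank r₂) ∩-side)
        (subst (_≤ rank r₂ (S ─ U₀) + rank r₂ ((S ─ W₀) ∪ ⁅ s ⁆))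
          (+-comm (rank r₂ ((S ─ U₀) ∪ ((S ─ W₀) ∪ ⁅ s ⁆))) (rank r₂ ((S ─ U₀) ∩ ((S ─ W₀) ∪ ⁅ s ⁆))))
          (submodular r₂ (S ─ U₀) ((S ─ W₀) ∪ ⁅ s ⁆)))

    uncross : ∀ W₀ → W₀ ⊆ S → ¬ rank (r₁ ／ s) W₀ + rank (r₂ ／ s) (S ─ W₀) < suc b + suc b + k
    uncross W₀ W₀⊆S W₀-violates = <-irrefl refl (begin-strict
      K + K ≤⟨ +-mono-≤ (bound U₁ U₁⊆) (bound U₂ U₂⊆) ⟩
      (rank r₁ U₁ + rank r₂ (S ∪ ⁅ s ⁆ ─ U₁)) + (rank r₁ U₂ + rank r₂ (S ∪ ⁅ s ⁆ ─ U₂))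
        ≡⟨ interchange (rank r₁ U₁) _ _ _ ⟩
      (rank r₁ U₁ + rank r₁ U₂) + (rank r₂ (S ∪ ⁅ s ⁆ ─ U₁) + rank r₂ (S ∪ ⁅ s ⁆ ─ U₂))
        ≤⟨ +-mono-≤ submodular₁ submodular₂ ⟩
      (rank r₁ U₀ + rank r₁ (W₀ ∪ ⁅ s ⁆)) + (rank r₂ (S ─ U₀) + rank r₂ ((S ─ W₀) ∪ ⁅ s ⁆))
        ≡⟨ interchange (rank r₁ U₀) _ _ _ ⟩
      (rank r₁ U₀ + rank r₂ (S ─ U₀)) + (rank r₁ (W₀ ∪ ⁅ s ⁆) + rank r₂ ((S ─ W₀) ∪ ⁅ s ⁆))
        <⟨ +-mono-<-≤ U₀-violates W₀∪⁅s⁆-bound ⟩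
      K + K ∎)
      where
      open ≤-Reasoning
      open Uncrossing W₀ W₀⊆S
      W₀∪⁅s⁆-bound : rank r₁ (W₀ ∪ ⁅ s ⁆) + rank r₂ ((S ─ W₀) ∪ ⁅ s ⁆) ≤ K
      W₀∪⁅s⁆-bound =
        ≤-pred (subst (rank r₁ (W₀ ∪ ⁅ s ⁆) + rank r₂ ((S ─ W₀) ∪ ⁅ s ⁆) <_) 2+b+b+k≡1+K W₀-violates)

    contracted-bound : RankSumBound (r₁ ／ s) (r₂ ／ s) S (suc b + suc b + k)
    contracted-bound W₀ W₀⊆S = ≮⇒≥ (uncross W₀ W₀⊆S)

  MatroidIntersection : Subset n → Set
  MatroidIntersection S = ∀ r₁ r₂ b k → rank r₁ ⊥ ≡ b → rank r₂ ⊥ ≡ b →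
    RankSumBound r₁ r₂ S (b + b + k) → CommonIndependent r₁ r₂ S b k

  ⊥-common-independent : ∀ r₁ r₂ S {b} → rank r₁ ⊥ ≡ b → rank r₂ ⊥ ≡ b →
    CommonIndependent r₁ r₂ S b 0
  ⊥-common-independent _ _ _ r₁⊥ r₂⊥ = ⊥ , ⊥⊆ , ∣⊥∣≡0 n , r₁⊥ , r₂⊥

  matroid-intersection-⊥ : MatroidIntersection ⊥
  matroid-intersection-⊥ r₁ r₂ b zero r₁⊥ r₂⊥ _ = ⊥-common-independent r₁ r₂ ⊥ r₁⊥ r₂⊥
  matroid-intersection-⊥ r₁ r₂ b (suc k) r₁⊥ r₂⊥ bound = Empty-elim (<-irrefl refl (begin-strict
    b + b <⟨ m<m+n (b + b) z<s ⟩
    b + b + suc k ≤⟨ bound ⊥ ⊥⊆ ⟩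
    rank r₁ ⊥ + rank r₂ (⊥ ─ ⊥) ≡⟨ cong₂ _+_ r₁⊥ (trans (cong (rank r₂) (p─⊥≡p ⊥)) r₂⊥) ⟩
    b + b ∎))
    where open ≤-Reasoning

  matroid-intersection-∪⁅⁆ : ∀ S s → s ∉ S → MatroidIntersection S → MatroidIntersection (S ∪ ⁅ s ⁆)
  matroid-intersection-∪⁅⁆ S s s∉S ih r₁ r₂ b zero r₁⊥ r₂⊥ _ =
    ⊥-common-independent r₁ r₂ (S ∪ ⁅ s ⁆) r₁⊥ r₂⊥
  matroid-intersection-∪⁅⁆ S s s∉S ih r₁ r₂ b (suc k) r₁⊥ r₂⊥ bound
    with rank-sum-bound? r₁ r₂ S (b + b + suc k)
  ... | inj₂ boundS = within-S∪⁅s⁆ (ih r₁ r₂ b (suc k) r₁⊥ r₂⊥ boundS)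
    where
    within-S∪⁅s⁆ : CommonIndependent r₁ r₂ S b (suc k) →
                   CommonIndependent r₁ r₂ (S ∪ ⁅ s ⁆) b (suc k)
    within-S∪⁅s⁆ (I , I⊆S , rest) = I , p⊆p∪q ⁅ s ⁆ ∘ I⊆S , rest
  ... | inj₁ (U₀ , U₀⊆S , U₀-violates) =
    add-s (ih (r₁ ／ s) (r₂ ／ s) (suc b) k rank₁-／s rank₂-／s contracted-bound)
    where
    open Violation r₁ r₂ S s s∉S b k r₁⊥ r₂⊥ bound U₀ U₀⊆S U₀-violates
    add-s : CommonIndependent (r₁ ／ s) (r₂ ／ s) S (suc b) k →
            CommonIndependent r₁ r₂ (S ∪ ⁅ s ⁆) b (suc k)
    add-s (I , I⊆S , ∣I∣≡k , r₁I , r₂I) =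
      I ∪ ⁅ s ⁆ , ∪-lub (p⊆p∪q ⁅ s ⁆ ∘ I⊆S) (q⊆p∪q S ⁅ s ⁆) ,
      trans (x∉p⇒∣p∪⁅x⁆∣≡1+∣p∣ (s∉S ∘ I⊆S)) (cong suc ∣I∣≡k) ,
      trans r₁I (+-suc k b) , trans r₂I (+-suc k b)

  matroid-intersection : ∀ S → MatroidIntersection S
  matroid-intersection =
    ∪⁅⁆-induction MatroidIntersection matroid-intersection-⊥ matroid-intersection-∪⁅⁆

-- The rank function of the partition matroid with capacity f c on the colour class of c

module _ {N k : ℕ} (col : Fin N → Fin k) where

  colourClass : Fin k → Subset N
  colourClass c = tabulate (λ e → ⌊ col e ≟ c ⌋)

  ∣p∣≡∑∣p∩colourClass∣ : ∀ p → ∣ p ∣ ≡ ∑[ c < k ] ∣ p ∩ colourClass c ∣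
  ∣p∣≡∑∣p∩colourClass∣ p = begin
    ∣ p ∣ ≡⟨ ∣p∣≡∑ p ⟩
    ∑[ e < N ] ⟦ lookup p e ⟧ ≡⟨ sum-cong-≗ per-edge ⟩
    ∑[ e < N ] ∑[ c < k ] ⟦ lookup (p ∩ colourClass c) e ⟧
      ≡⟨ ∑-comm (λ e c → ⟦ lookup (p ∩ colourClass c) e ⟧) ⟩
    ∑[ c < k ] ∑[ e < N ] ⟦ lookup (p ∩ colourClass c) e ⟧
      ≡⟨ sum-cong-≗ (sym ∘ ∣p∣≡∑ ∘ (p ∩_) ∘ colourClass) ⟩
    ∑[ c < k ] ∣ p ∩ colourClass c ∣ ∎
    where
    open ≡-Reasoning
    per-edge : ∀ e → ⟦ lookup p e ⟧ ≡ ∑[ c < k ] ⟦ lookup (p ∩ colourClass c) e ⟧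
    per-edge e = trans (indicator (lookup p e)) (sum-cong-≗ (cong ⟦_⟧ ∘ sym ∘ lookup-∩-colourClass))
      where
      lookup-∩-colourClass : ∀ c → lookup (p ∩ colourClass c) e ≡ lookup p e ∧ ⌊ col e ≟ c ⌋
      lookup-∩-colourClass c =
        trans (lookup-zipWith _∧_ e p (colourClass c)) (cong (lookup p e ∧_) (lookup∘tabulate _ e))
      indicator : ∀ b → ⟦ b ⟧ ≡ ∑[ c < k ] ⟦ b ∧ ⌊ col e ≟ c ⌋ ⟧
      indicator true = sym (∑⟦x≟c⟧≡1 (col e))
      indicator false = sym (∑-zero {k} (λ _ → refl))

  module _ (f : Fin k → ℕ) where
    open import Algebra.Solver.IdempotentCommutativeMonoid (∩-idempotentCommutativeMonoid N)

    partitionRank : SubmodularRank N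
    rank partitionRank p = ∑[ c < k ] (f c ⊓ ∣ p ∩ colourClass c ∣)
    submodular partitionRank p q = begin
      rank partitionRank (p ∪ q) + rank partitionRank (p ∩ q)
        ≡⟨ ∑-distrib-+ (λ c → f c ⊓ ∣ (p ∪ q) ∩ K c ∣) _ ⟨
      ∑[ c < k ] (f c ⊓ ∣ (p ∪ q) ∩ K c ∣ + f c ⊓ ∣ (p ∩ q) ∩ K c ∣) ≡⟨ sum-cong-≗ split ⟩
      ∑[ c < k ] (f c ⊓ ∣ (p ∩ K c) ∪ (q ∩ K c) ∣ + f c ⊓ ∣ (p ∩ K c) ∩ (q ∩ K c) ∣)
        ≤⟨ ∑-mono-≤ (λ c → ⊓∣∣-submodular (f c) (p ∩ K c) (q ∩ K c)) ⟩
      ∑[ c < k ] (f c ⊓ ∣ p ∩ K c ∣ + f c ⊓ ∣ q ∩ K c ∣) ≡⟨ ∑-distrib-+ (λ c → f c ⊓ ∣ p ∩ K c ∣) _ ⟩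
      rank partitionRank p + rank partitionRank q ∎
      where
      open ≤-Reasoning
      K = colourClass
      split : ∀ c → f c ⊓ ∣ (p ∪ q) ∩ K c ∣ + f c ⊓ ∣ (p ∩ q) ∩ K c ∣ ≡
                    f c ⊓ ∣ (p ∩ K c) ∪ (q ∩ K c) ∣ + f c ⊓ ∣ (p ∩ K c) ∩ (q ∩ K c) ∣
      split c = cong₂ (λ P Q → f c ⊓ ∣ P ∣ + f c ⊓ ∣ Q ∣) (∩-distribʳ-∪ (K c) p q)
        (solve 3 (λ p q K → (p ⊕ q) ⊕ K ⊜ (p ⊕ K) ⊕ (q ⊕ K)) refl p q (K c))
    unit-increase partitionRank p x = begin
      ∑[ c < k ] (f c ⊓ ∣ (p ∪ ⁅ x ⁆) ∩ K c ∣) ≤⟨ ∑-mono-≤ per-colour ⟩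
      ∑[ c < k ] (f c ⊓ ∣ p ∩ K c ∣ + ∣ ⁅ x ⁆ ∩ K c ∣) ≡⟨ ∑-distrib-+ (λ c → f c ⊓ ∣ p ∩ K c ∣) _ ⟩
      rank partitionRank p + ∑[ c < k ] ∣ ⁅ x ⁆ ∩ K c ∣ ≡⟨ cong (rank partitionRank p +_) ∑∣⁅x⁆∩K∣≡1 ⟩
      rank partitionRank p + 1 ≡⟨ +-comm _ 1 ⟩
      suc (rank partitionRank p) ∎
      where
      open ≤-Reasoning
      K = colourClass
      ∑∣⁅x⁆∩K∣≡1 : ∑[ c < k ] ∣ ⁅ x ⁆ ∩ K c ∣ ≡ 1
      ∑∣⁅x⁆∩K∣≡1 = trans (sym (∣p∣≡∑∣p∩colourClass∣ ⁅ x ⁆)) (∣⁅x⁆∣≡1 x)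
      per-colour : ∀ c → f c ⊓ ∣ (p ∪ ⁅ x ⁆) ∩ K c ∣ ≤ f c ⊓ ∣ p ∩ K c ∣ + ∣ ⁅ x ⁆ ∩ K c ∣
      per-colour c = begin
        f c ⊓ ∣ (p ∪ ⁅ x ⁆) ∩ K c ∣ ≡⟨ cong (λ P → f c ⊓ ∣ P ∣) (∩-distribʳ-∪ (K c) p ⁅ x ⁆) ⟩
        f c ⊓ ∣ (p ∩ K c) ∪ (⁅ x ⁆ ∩ K c) ∣ ≤⟨ ⊓-monoʳ-≤ (f c) (∣p∪q∣≤∣p∣+∣q∣ (p ∩ K c) (⁅ x ⁆ ∩ K c)) ⟩
        f c ⊓ (∣ p ∩ K c ∣ + ∣ ⁅ x ⁆ ∩ K c ∣) ≤⟨ f⊓[x+d]≤f⊓x+d (f c) _ _ ⟩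
        f c ⊓ ∣ p ∩ K c ∣ + ∣ ⁅ x ⁆ ∩ K c ∣ ∎

    partitionRank-⊥ : rank partitionRank ⊥ ≡ 0
    partitionRank-⊥ = ∑-zero λ c →
      trans (cong (f c ⊓_) (trans (cong ∣_∣ (∩-zeroˡ (colourClass c))) (∣⊥∣≡0 N))) (⊓-zeroʳ (f c))

    partition-independent⇒capacity : ∀ p → rank partitionRank p ≡ ∣ p ∣ →
      ∀ c → ∣ p ∩ colourClass c ∣ ≤ f c
    partition-independent⇒capacity p indep c = subst (_≤ f c)
      (∑-≤-tight (λ c → m⊓n≤n (f c) _) (trans indep (∣p∣≡∑∣p∩colourClass∣ p)) c) (m⊓n≤m (f c) _)

-- Reachability and components

module _ {n : ℕ} where

  infix 4 _⊑_
  _⊑_ : EdgeSet n → EdgeSet n → Set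
  E ⊑ E' = ∀ u v → E u v ≡ true → E' u v ≡ true

  IsSymmetric : EdgeSet n → Set
  IsSymmetric E = ∀ u v → E u v ≡ E v u

  reach-mono : ∀ {E E'} → E ⊑ E' → ∀ {u v} → Reach E u v → Reach E' u v
  reach-mono E⊑E' here = here
  reach-mono E⊑E' (step e r) = step (E⊑E' _ _ e) (reach-mono E⊑E' r)

  reach-trans : ∀ {E : EdgeSet n} {u v w} → Reach E u v → Reach E v w → Reach E u w
  reach-trans here r = r
  reach-trans (step e r) r' = step e (reach-trans r r')

  reach-sym : ∀ {E : EdgeSet n} → IsSymmetric E → ∀ {u v} → Reach E u v → Reach E v u
  reach-sym sym-E here = here
  reach-sym sym-E (step {v = v} e r) = reach-trans (reach-sym sym-E r) (step (trans (sym-E v _) e) here)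

  module _ {E : EdgeSet n} {j : ℕ} (h : HasComponents E j) where
    private
      label = proj₁ h

    same-label⇒reach : ∀ {u v} → label u ≡ label v → Reach E u v
    same-label⇒reach = Equivalence.to (proj₂ (proj₂ h) _ _)

    reach⇒same-label : ∀ {u v} → Reach E u v → label u ≡ label v
    reach⇒same-label = Equivalence.from (proj₂ (proj₂ h) _ _)

    representative : Fin j → Fin n
    representative c = proj₁ (proj₁ (proj₂ h) c)

    label-representative : ∀ c → label (representative c) ≡ c
    label-representative c = proj₂ (proj₁ (proj₂ h) c) refl

  components-cong : ∀ {E E' j} → E ⊑ E' → E' ⊑ E → HasComponents E j → HasComponents E' j
  components-cong E⊑E' E'⊑E (label , surj , same⇔reach) = label , surj , λ u v → mk⇔
    (reach-mono E⊑E' ∘ Equivalence.to (same⇔reach u v))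
    (Equivalence.from (same⇔reach u v) ∘ reach-mono E'⊑E)

  -- Representatives of distinct components of E' lie in distinct components of the subgraph E.
  components-antitone : ∀ {E E' j j'} → E ⊑ E' → HasComponents E j → HasComponents E' j' → j' ≤ j
  components-antitone E⊑E' h h' = injective⇒≤ {f = proj₁ h ∘ representative h'} λ {c} {d} eq → begin
    c ≡⟨ label-representative h' c ⟨
    proj₁ h' (representative h' c) ≡⟨ reach⇒same-label h' (reach-mono E⊑E' (same-label⇒reach h eq)) ⟩
    proj₁ h' (representative h' d) ≡⟨ label-representative h' d ⟩
    d ∎
    where open ≡-Reasoning

  components-unique : ∀ {E : EdgeSet n} {j j'} → HasComponents E j → HasComponents E j' → j ≡ j'
  components-unique h h' =
    ≤-antisym (components-antitone (λ _ _ e → e) h' h) (components-antitone (λ _ _ e → e) h h')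

  components≤n : ∀ {E : EdgeSet n} {j} → HasComponents E j → j ≤ n
  components≤n h = injective⇒≤ {f = representative h} λ {c} {d} eq →
    trans (sym (label-representative h c)) (trans (cong (proj₁ h) eq) (label-representative h d))

  noEdges : EdgeSet n
  noEdges _ _ = false

  components-noEdges : HasComponents noEdges n
  components-noEdges = (λ u → u) , (λ u → u , λ eq → eq) , λ u v → mk⇔ (λ { refl → here }) reach⇒≡
    where
    reach⇒≡ : ∀ {u v} → Reach noEdges u v → u ≡ v
    reach⇒≡ here = refl
    reach⇒≡ (step () _)

-- Sending p to q and then punching out p identifies exactly the labels p and q.
module MergeLabels {j : ℕ} (p q : Fin (suc j)) (p≢q : p ≢ q) where

  redirect : Fin (suc j) → Fin (suc j)
  redirect i with i ≟ p
  ... | yes _ = q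
  ... | no _ = i

  redirect-p : redirect p ≡ q
  redirect-p with p ≟ p
  ... | yes _ = refl
  ... | no p≢p = Empty-elim (p≢p refl)

  redirect-fixes : ∀ {i} → i ≢ p → redirect i ≡ i
  redirect-fixes {i} i≢p with i ≟ p
  ... | yes i≡p = Empty-elim (i≢p i≡p)
  ... | no _ = refl

  p≢redirect : ∀ i → p ≢ redirect i
  p≢redirect i with i ≟ p
  ... | yes _ = p≢q
  ... | no i≢p = i≢p ∘ sym

  merge : Fin (suc j) → Fin j
  merge i = punchOut (p≢redirect i)

  merge-≡⇒redirect-≡ : ∀ {i i'} → merge i ≡ merge i' → redirect i ≡ redirect i'
  merge-≡⇒redirect-≡ {i} {i'} = punchOut-injective (p≢redirect i) (p≢redirect i')

  redirect-≡⇒merge-≡ : ∀ {i i'} → redirect i ≡ redirect i' → merge i ≡ merge i'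
  redirect-≡⇒merge-≡ = punchOut-cong p

  merge-punchIn : ∀ t → merge (punchIn p t) ≡ t
  merge-punchIn t = trans (punchOut-cong p (redirect-fixes (punchInᵢ≢i p t))) (punchOut-punchIn p)

module AddEdge {n : ℕ} (E E' : EdgeSet n) (a b : Fin n) (E⊑E' : E ⊑ E')
  (ab : E' a b ≡ true) (ba : E' b a ≡ true)
  (new-edge : ∀ u v → E' u v ≡ true → E u v ≡ true ⊎ (u ≡ a × v ≡ b) ⊎ (u ≡ b × v ≡ a)) where

  ReachVia : Fin n → Fin n → Set
  ReachVia u v = Reach E u v ⊎ (Reach E u a × Reach E b v) ⊎ (Reach E u b × Reach E a v)

  reach-decompose : ∀ {u v} → Reach E' u v → ReachVia u v
  reach-decompose here = inj₁ here
  reach-decompose {u} (step {v = w} e r) with new-edge u w e | reach-decompose r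
  ... | inj₁ uw | inj₁ wv = inj₁ (step uw wv)
  ... | inj₁ uw | inj₂ (inj₁ (wa , bv)) = inj₂ (inj₁ (step uw wa , bv))
  ... | inj₁ uw | inj₂ (inj₂ (wb , av)) = inj₂ (inj₂ (step uw wb , av))
  ... | inj₂ (inj₁ (refl , refl)) | inj₁ wv = inj₂ (inj₁ (here , wv))
  ... | inj₂ (inj₁ (refl , refl)) | inj₂ (inj₁ (_ , bv)) = inj₂ (inj₁ (here , bv))
  ... | inj₂ (inj₁ (refl , refl)) | inj₂ (inj₂ (_ , av)) = inj₁ av
  ... | inj₂ (inj₂ (refl , refl)) | inj₁ wv = inj₂ (inj₂ (here , wv))
  ... | inj₂ (inj₂ (refl , refl)) | inj₂ (inj₁ (_ , bv)) = inj₁ bv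
  ... | inj₂ (inj₂ (refl , refl)) | inj₂ (inj₂ (_ , av)) = inj₂ (inj₂ (here , av))

  via-ab : ∀ {u v} → Reach E u a → Reach E b v → Reach E' u v
  via-ab ua bv = reach-trans (reach-mono E⊑E' ua) (step ab (reach-mono E⊑E' bv))

  via-ba : ∀ {u v} → Reach E u b → Reach E a v → Reach E' u v
  via-ba ub av = reach-trans (reach-mono E⊑E' ub) (step ba (reach-mono E⊑E' av))

  module _ {j : ℕ} (h : HasComponents E j) where
    private
      label = proj₁ h

    components-same : label a ≡ label b → HasComponents E' j
    components-same a~b = label , proj₁ (proj₂ h) , λ u v → mk⇔
      (reach-mono E⊑E' ∘ same-label⇒reach h) (same-label ∘ reach-decompose)
      where
      same-label : ∀ {u v} → ReachVia u v → label u ≡ label v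
      same-label (inj₁ uv) = reach⇒same-label h uv
      same-label (inj₂ (inj₁ (ua , bv))) =
        trans (reach⇒same-label h ua) (trans a~b (reach⇒same-label h bv))
      same-label (inj₂ (inj₂ (ub , av))) =
        trans (reach⇒same-label h ub) (trans (sym a~b) (reach⇒same-label h av))

  components-merged : ∀ {j} (h : HasComponents E (suc j)) → proj₁ h a ≢ proj₁ h b →
    HasComponents E' j
  components-merged {j} h a≁b = merge ∘ label , surjective , λ u v → mk⇔ (to u v) (from u v)
    where
    open ≡-Reasoning
    label = proj₁ h
    open MergeLabels (label b) (label a) (a≁b ∘ sym)

    surjective : ∀ t → ∃ λ x → ∀ {z} → z ≡ x → merge (label z) ≡ t
    surjective t = representative h (punchIn (label b) t) , λ { refl →
      trans (cong merge (label-representative h _)) (merge-punchIn t) }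

    to : ∀ u v → merge (label u) ≡ merge (label v) → Reach E' u v
    to u v eq with merge-≡⇒redirect-≡ {label u} {label v} eq | label u ≟ label b | label v ≟ label b
    ... | e | yes ub | yes vb = reach-mono E⊑E' (same-label⇒reach h (trans ub (sym vb)))
    ... | e | yes ub | no vb = via-ba (same-label⇒reach h ub) (same-label⇒reach h (begin
          label a ≡⟨ redirect-p ⟨
          redirect (label b) ≡⟨ cong redirect ub ⟨
          redirect (label u) ≡⟨ e ⟩
          redirect (label v) ≡⟨ redirect-fixes vb ⟩
          label v ∎))
    ... | e | no ub | yes vb = via-ab (same-label⇒reach h (begin
          label u ≡⟨ redirect-fixes ub ⟨
          redirect (label u) ≡⟨ e ⟩
          redirect (label v) ≡⟨ cong redirect vb ⟩
          redirect (label b) ≡⟨ redirect-p ⟩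
          label a ∎)) (same-label⇒reach h (sym vb))
    ... | e | no ub | no vb = reach-mono E⊑E' (same-label⇒reach h (begin
          label u ≡⟨ redirect-fixes ub ⟨
          redirect (label u) ≡⟨ e ⟩
          redirect (label v) ≡⟨ redirect-fixes vb ⟩
          label v ∎))

    from : ∀ u v → Reach E' u v → merge (label u) ≡ merge (label v)
    from u v uv = redirect-≡⇒merge-≡ {label u} {label v} (same-redirect (reach-decompose uv))
      where
      same-redirect : ReachVia u v → redirect (label u) ≡ redirect (label v)
      same-redirect (inj₁ uv) = cong redirect (reach⇒same-label h uv)
      same-redirect (inj₂ (inj₁ (ua , bv))) = begin
        redirect (label u) ≡⟨ cong redirect (reach⇒same-label h ua) ⟩
        redirect (label a) ≡⟨ redirect-fixes a≁b ⟩
        label a ≡⟨ redirect-p ⟨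
        redirect (label b) ≡⟨ cong redirect (reach⇒same-label h bv) ⟩
        redirect (label v) ∎
      same-redirect (inj₂ (inj₂ (ub , av))) = begin
        redirect (label u) ≡⟨ cong redirect (reach⇒same-label h ub) ⟩
        redirect (label b) ≡⟨ redirect-p ⟩
        label a ≡⟨ redirect-fixes a≁b ⟨
        redirect (label a) ≡⟨ cong redirect (reach⇒same-label h av) ⟩
        redirect (label v) ∎

  components-add-edge : ∀ {j} → HasComponents E j →
    (Reach E a b × HasComponents E' j) ⊎ (¬ Reach E a b × ∃ λ j' → j ≡ suc j' × HasComponents E' j')
  components-add-edge {j} h with proj₁ h a ≟ proj₁ h b
  ... | yes a~b = inj₁ (same-label⇒reach h a~b , components-same h a~b)
  components-add-edge {zero} h | no _ = Empty-elim (¬Fin0 (proj₁ h a))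
  components-add-edge {suc j} h | no a≁b =
    inj₂ (a≁b ∘ reach⇒same-label h , j , refl , components-merged h a≁b)

-- Subgraphs of the complete graph on Fin n, with the edge {u , v} indexed by combine u v

module CompleteGraph (n : ℕ) where

  source target : Fin (n * n) → Fin n
  source e = proj₁ (remQuot {n} n e)
  target e = proj₂ (remQuot {n} n e)

  source-target-combine : ∀ u v → (source (combine u v) , target (combine u v)) ≡ (u , v)
  source-target-combine = remQuot-combine

  edges : Subset (n * n) → EdgeSet n
  edges A u v = lookup A (combine u v) ∨ lookup A (combine v u)

  edges-sym : ∀ A → IsSymmetric (edges A)
  edges-sym A u v = ∨-comm (lookup A (combine u v)) (lookup A (combine v u))

  edges-true⁻ : ∀ {A u v} → edges A u v ≡ true → combine u v ∈ A ⊎ combine v u ∈ A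
  edges-true⁻ {A} {u} {v} e with ∨-true⁻ (lookup A (combine u v)) e
  ... | inj₁ uv = inj₁ (lookup⇒[]= _ A uv)
  ... | inj₂ vu = inj₂ (lookup⇒[]= _ A vu)

  edges-true⁺ : ∀ A u v → combine u v ∈ A ⊎ combine v u ∈ A → edges A u v ≡ true
  edges-true⁺ A u v (inj₁ uv) = ∨-true⁺ˡ _ ([]=⇒lookup uv)
  edges-true⁺ A u v (inj₂ vu) = ∨-true⁺ʳ (lookup A (combine u v)) ([]=⇒lookup vu)

  edges-mono : ∀ {A B} → A ⊆ B → edges A ⊑ edges B
  edges-mono {A} {B} A⊆B u v = edges-true⁺ B u v ∘ Data.Sum.map A⊆B A⊆B ∘ edges-true⁻ {A} {u} {v}

  edges-⊥ : edges ⊥ ⊑ noEdges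
  edges-⊥ u v e = Empty-elim ([ ∉⊥ , ∉⊥ ]′ (edges-true⁻ {⊥} {u} {v} e))

  module AddEdgeIndex (A : Subset (n * n)) (e : Fin (n * n)) where
    a = source e
    b = target e

    ab∈ : combine a b ∈ A ∪ ⁅ e ⁆
    ab∈ = subst (_∈ A ∪ ⁅ e ⁆) (sym (combine-remQuot {n} n e)) (q⊆p∪q A ⁅ e ⁆ (x∈⁅x⁆ e))

    endpoints : ∀ {u v} → combine u v ∈ ⁅ e ⁆ → u ≡ a × v ≡ b
    endpoints {u} {v} uv∈e =
      ,-injective (trans (sym (source-target-combine u v)) (cong (remQuot {n} n) (x∈⁅y⁆⇒x≡y e uv∈e)))

    new-edge : ∀ u v → edges (A ∪ ⁅ e ⁆) u v ≡ true →
      edges A u v ≡ true ⊎ (u ≡ a × v ≡ b) ⊎ (u ≡ b × v ≡ a)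
    new-edge u v uv with edges-true⁻ {A ∪ ⁅ e ⁆} {u} {v} uv
    ... | inj₁ uv∈ = [ inj₁ ∘ edges-true⁺ A u v ∘ inj₁ , inj₂ ∘ inj₁ ∘ endpoints ]′
                       (x∈p∪q⁻ A ⁅ e ⁆ uv∈)
    ... | inj₂ vu∈ = [ inj₁ ∘ edges-true⁺ A u v ∘ inj₂ , inj₂ ∘ inj₂ ∘ swap ∘ endpoints ]′
                       (x∈p∪q⁻ A ⁅ e ⁆ vu∈)

    open AddEdge (edges A) (edges (A ∪ ⁅ e ⁆)) a b (edges-mono {A} {A ∪ ⁅ e ⁆} (p⊆p∪q ⁅ e ⁆))
      (edges-true⁺ (A ∪ ⁅ e ⁆) a b (inj₁ ab∈)) (edges-true⁺ (A ∪ ⁅ e ⁆) b a (inj₂ ab∈)) new-edge public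

  components-exist : ∀ A → ∃ (HasComponents (edges A))
  components-exist = ∪⁅⁆-induction _ (n , components-cong (λ _ _ ()) edges-⊥ components-noEdges) add
    where
    add : ∀ A e → e ∉ A → ∃ (HasComponents (edges A)) → ∃ (HasComponents (edges (A ∪ ⁅ e ⁆)))
    add A e _ (j , h) with AddEdgeIndex.components-add-edge A e h
    ... | inj₁ (_ , h') = j , h'
    ... | inj₂ (_ , j' , _ , h') = j' , h'

  ω : Subset (n * n) → ℕ
  ω A = proj₁ (components-exist A)

  ω-components : ∀ A → HasComponents (edges A) (ω A)
  ω-components A = proj₂ (components-exist A)

  ω-unique : ∀ A {j} → HasComponents (edges A) j → ω A ≡ j
  ω-unique A = components-unique (ω-components A)

  ω-antitone : ∀ {A B} → A ⊆ B → ω B ≤ ω A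
  ω-antitone {A} {B} A⊆B = components-antitone (edges-mono A⊆B) (ω-components A) (ω-components B)

  ω≤n : ∀ A → ω A ≤ n
  ω≤n A = components≤n (ω-components A)

  ω-⊥ : ω ⊥ ≡ n
  ω-⊥ = ω-unique ⊥ (components-cong (λ _ _ ()) edges-⊥ components-noEdges)

  ω-∪⁅⁆ : ∀ A e → let a = source e ; b = target e in
    (Reach (edges A) a b × ω (A ∪ ⁅ e ⁆) ≡ ω A) ⊎ (¬ Reach (edges A) a b × ω A ≡ suc (ω (A ∪ ⁅ e ⁆)))
  ω-∪⁅⁆ A e with AddEdgeIndex.components-add-edge A e (ω-components A)
  ... | inj₁ (ab , h) = inj₁ (ab , ω-unique (A ∪ ⁅ e ⁆) h)
  ... | inj₂ (¬ab , j , ωA≡1+j , h) =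
    inj₂ (¬ab , trans ωA≡1+j (cong suc (sym (ω-unique (A ∪ ⁅ e ⁆) h))))

  ω≤1+ω-∪⁅⁆ : ∀ A e → ω A ≤ suc (ω (A ∪ ⁅ e ⁆))
  ω≤1+ω-∪⁅⁆ A e with ω-∪⁅⁆ A e
  ... | inj₁ (_ , eq) = subst (λ j → ω A ≤ suc j) (sym eq) (n≤1+n (ω A))
  ... | inj₂ (_ , eq) = ≤-reflexive eq

  ω[A]≤ω[A∪Z]+∣Z∣ : ∀ A Z → ω A ≤ ω (A ∪ Z) + ∣ Z ∣
  ω[A]≤ω[A∪Z]+∣Z∣ A = ∪⁅⁆-induction (λ Z → ω A ≤ ω (A ∪ Z) + ∣ Z ∣) base add
    where
    base : ω A ≤ ω (A ∪ ⊥) + ∣ ⊥ {n = n * n} ∣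
    base = ≤-reflexive (sym (trans (cong₂ _+_ (cong ω (∪-identityʳ A)) (∣⊥∣≡0 (n * n)))
                                   (+-identityʳ (ω A))))
    add : ∀ Z z → z ∉ Z → ω A ≤ ω (A ∪ Z) + ∣ Z ∣ → ω A ≤ ω (A ∪ (Z ∪ ⁅ z ⁆)) + ∣ Z ∪ ⁅ z ⁆ ∣
    add Z z z∉Z ih = begin
      ω A ≤⟨ ih ⟩
      ω (A ∪ Z) + ∣ Z ∣ ≤⟨ +-monoˡ-≤ ∣ Z ∣ (ω≤1+ω-∪⁅⁆ (A ∪ Z) z) ⟩
      suc (ω ((A ∪ Z) ∪ ⁅ z ⁆)) + ∣ Z ∣ ≡⟨ +-suc (ω ((A ∪ Z) ∪ ⁅ z ⁆)) ∣ Z ∣ ⟨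
      ω ((A ∪ Z) ∪ ⁅ z ⁆) + suc ∣ Z ∣
        ≡⟨ cong₂ _+_ (cong ω (∪-assoc A Z ⁅ z ⁆)) (sym (x∉p⇒∣p∪⁅x⁆∣≡1+∣p∣ z∉Z)) ⟩
      ω (A ∪ (Z ∪ ⁅ z ⁆)) + ∣ Z ∪ ⁅ z ⁆ ∣ ∎
      where open ≤-Reasoning

  ω-supermodular : ∀ {X Y} → X ⊆ Y → ∀ D → ω Y + ω (X ∪ D) ≤ ω X + ω (Y ∪ D)
  ω-supermodular {X} {Y} X⊆Y = ∪⁅⁆-induction (λ D → ω Y + ω (X ∪ D) ≤ ω X + ω (Y ∪ D)) base add
    where
    base : ω Y + ω (X ∪ ⊥) ≤ ω X + ω (Y ∪ ⊥)
    base = ≤-reflexive (trans (cong₂ _+_ refl (cong ω (∪-identityʳ X)))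
                        (trans (+-comm (ω Y) (ω X)) (cong (ω X +_) (cong ω (sym (∪-identityʳ Y))))))
    add : ∀ D d → d ∉ D → ω Y + ω (X ∪ D) ≤ ω X + ω (Y ∪ D) →
          ω Y + ω (X ∪ (D ∪ ⁅ d ⁆)) ≤ ω X + ω (Y ∪ (D ∪ ⁅ d ⁆))
    add D d _ ih = subst₂ (λ p q → ω Y + ω p ≤ ω X + ω q) (∪-assoc X D ⁅ d ⁆) (∪-assoc Y D ⁅ d ⁆)
      (cases (ω-∪⁅⁆ (X ∪ D) d) (ω-∪⁅⁆ (Y ∪ D) d))
      where
      a = source d
      b = target d
      X′ = X ∪ D
      Y′ = Y ∪ D
      X′⊆Y′ : X′ ⊆ Y′
      X′⊆Y′ = ∪-lub (p⊆p∪q D ∘ X⊆Y) (q⊆p∪q Y D)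
      AddsEdge : Subset (n * n) → Set
      AddsEdge A = (Reach (edges A) a b × ω (A ∪ ⁅ d ⁆) ≡ ω A) ⊎
                   (¬ Reach (edges A) a b × ω A ≡ suc (ω (A ∪ ⁅ d ⁆)))
      cases : AddsEdge X′ → AddsEdge Y′ → ω Y + ω (X′ ∪ ⁅ d ⁆) ≤ ω X + ω (Y′ ∪ ⁅ d ⁆)
      cases (inj₁ (_ , eqX)) (inj₁ (_ , eqY)) = subst₂ (λ p q → ω Y + p ≤ ω X + q) (sym eqX) (sym eqY) ih
      cases (inj₁ (abX , _)) (inj₂ (¬abY , _)) = Empty-elim (¬abY (reach-mono (edges-mono X′⊆Y′) abX))
      cases (inj₂ (_ , eqX)) (inj₁ (_ , eqY)) = begin
        ω Y + ω (X′ ∪ ⁅ d ⁆) ≤⟨ +-monoʳ-≤ (ω Y) (≤-trans (n≤1+n _) (≤-reflexive (sym eqX))) ⟩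
        ω Y + ω X′ ≤⟨ ih ⟩
        ω X + ω Y′ ≡⟨ cong (ω X +_) eqY ⟨
        ω X + ω (Y′ ∪ ⁅ d ⁆) ∎
        where open ≤-Reasoning
      cases (inj₂ (_ , eqX)) (inj₂ (_ , eqY)) = +-cancelʳ-≤ 1 _ _ (begin
        ω Y + ω (X′ ∪ ⁅ d ⁆) + 1
          ≡⟨ trans (+-assoc (ω Y) _ 1) (cong (ω Y +_) (trans (+-comm _ 1) (sym eqX))) ⟩
        ω Y + ω X′ ≤⟨ ih ⟩
        ω X + ω Y′
          ≡⟨ trans (cong (ω X +_) (trans eqY (+-comm 1 _))) (sym (+-assoc (ω X) _ 1)) ⟩
        ω X + ω (Y′ ∪ ⁅ d ⁆) + 1 ∎)
        where open ≤-Reasoning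

  graphicRank : SubmodularRank (n * n)
  rank graphicRank A = n ∸ ω A
  submodular graphicRank A B = begin
    (n ∸ ω (A ∪ B)) + (n ∸ ω (A ∩ B)) ≡⟨ [m∸a]+[m∸b]≡[m+m]∸[a+b] (ω≤n (A ∪ B)) (ω≤n (A ∩ B)) ⟩
    (n + n) ∸ (ω (A ∪ B) + ω (A ∩ B)) ≤⟨ ∸-monoʳ-≤ (n + n) supermodular ⟩
    (n + n) ∸ (ω A + ω B) ≡⟨ [m∸a]+[m∸b]≡[m+m]∸[a+b] (ω≤n A) (ω≤n B) ⟨
    (n ∸ ω A) + (n ∸ ω B) ∎
    where
    open ≤-Reasoning
    [A∩B]∪B≡B : (A ∩ B) ∪ B ≡ B
    [A∩B]∪B≡B = trans (∪-comm (A ∩ B) B) (trans (cong (B ∪_) (∩-comm A B)) (∪-abs-∩ B A))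
    supermodular : ω A + ω B ≤ ω (A ∪ B) + ω (A ∩ B)
    supermodular = subst₂ (λ p q → ω A + ω p ≤ q) [A∩B]∪B≡B (+-comm (ω (A ∩ B)) (ω (A ∪ B)))
      (ω-supermodular (p∩q⊆p A B) B)
  unit-increase graphicRank A e = m∸w≤1+m∸a n (ω≤1+ω-∪⁅⁆ A e)

  graphic-rank≤card : ∀ A → n ∸ ω A ≤ ∣ A ∣
  graphic-rank≤card A = m≤n+o⇒m∸n≤o n (ω A)
    (subst₂ (λ p q → p ≤ ω q + ∣ A ∣) ω-⊥ (∪-identityˡ A) (ω[A]≤ω[A∪Z]+∣Z∣ ⊥ A))

  independent⇒bridge : ∀ J {x y} → combine x y ∉ J →
    n ∸ ω (J ∪ ⁅ combine x y ⁆) ≡ ∣ J ∪ ⁅ combine x y ⁆ ∣ → ¬ Reach (edges J) x y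
  independent⇒bridge J {x} {y} xy∉J indep xy with ω-∪⁅⁆ J (combine x y)
  ... | inj₂ (¬xy , _) =
    ¬xy (subst (λ (a , b) → Reach (edges J) a b) (sym (source-target-combine x y)) xy)
  ... | inj₁ (_ , ω-same) = <-irrefl refl (begin-strict
    ∣ J ∣ <⟨ n<1+n ∣ J ∣ ⟩
    suc ∣ J ∣ ≡⟨ trans (sym (x∉p⇒∣p∪⁅x⁆∣≡1+∣p∣ xy∉J)) (sym indep) ⟩
    n ∸ ω (J ∪ ⁅ combine x y ⁆) ≡⟨ cong (n ∸_) ω-same ⟩
    n ∸ ω J ≤⟨ graphic-rank≤card J ⟩
    ∣ J ∣ ∎)
    where open ≤-Reasoning

  module _ (I : Subset (n * n)) (x y : Fin n) (e : Fin (n * n))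
           (e-xy : e ≡ combine x y ⊎ e ≡ combine y x) where

    edge-other-than-e : ∀ {p q} → combine p q ∈ I → ¬ (p ≡ x × q ≡ y) → ¬ (p ≡ y × q ≡ x) →
      combine p q ∈ I - e
    edge-other-than-e {p} {q} pq∈I ¬xy ¬yx = x∈p∧x≢y⇒x∈p-y pq∈I ([ pq≢xy , pq≢yx ]′ e-xy)
      where
      pq≢xy : e ≡ combine x y → combine p q ≢ e
      pq≢xy refl pq≡xy = ¬xy (combine-injectiveˡ p q x y pq≡xy , combine-injectiveʳ p q x y pq≡xy)
      pq≢yx : e ≡ combine y x → combine p q ≢ e
      pq≢yx refl pq≡yx = ¬yx (combine-injectiveˡ p q y x pq≡yx , combine-injectiveʳ p q y x pq≡yx)

    edges-other-than-e : ∀ {p q} → edges I p q ≡ true → ¬ (p ≡ x × q ≡ y) → ¬ (p ≡ y × q ≡ x) →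
      edges (I - e) p q ≡ true
    edges-other-than-e {p} {q} pq ¬xy ¬yx = edges-true⁺ (I - e) p q (Data.Sum.map
      (λ pq∈ → edge-other-than-e pq∈ ¬xy ¬yx) (λ qp∈ → edge-other-than-e qp∈ (¬yx ∘ swap) (¬xy ∘ swap))
      (edges-true⁻ {I} {p} {q} pq))

    -- The rest x ← z ← ⋯ of a cycle through the edge {x , y}, starting next to y, avoids that edge.
    walk-avoiding-e : ∀ z zs → All (x ≢_) (z ∷ zs) → All (y ≢_) zs → (zs ≡ [] → y ≢ z) →
      IsWalk (edges I) (z ∷ zs ++ [ x ]) → Reach (edges (I - e)) z x
    walk-avoiding-e z [] (x≢z ∷ []) _ y≢z (cons zx one) =
      step (edges-other-than-e zx (λ (z≡x , _) → x≢z (sym z≡x)) (λ (z≡y , _) → y≢z refl (sym z≡y))) here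
    walk-avoiding-e z (z′ ∷ zs) (x≢z ∷ x≢z′∷) (y≢z′ ∷ y≢zs) _ (cons zz′ walk) =
      step (edges-other-than-e zz′ (λ (z≡x , _) → x≢z (sym z≡x)) (λ (_ , z′≡x) → All.head x≢z′∷ (sym z′≡x)))
           (walk-avoiding-e z′ zs x≢z′∷ y≢zs (λ _ → y≢z′) walk)

  independent⇒acyclic : ∀ I → n ∸ ω I ≡ ∣ I ∣ → Acyclic (edges I)
  independent⇒acyclic I indep (x , [] , s≤s () , _)
  independent⇒acyclic I indep (x , y ∷ [] , s≤s (s≤s ()) , _)
  independent⇒acyclic I indep (x , y ∷ y′ ∷ ys , _ , (x≢ ∷ y≢ ∷ _) , cons xy walk) =
    [ (λ xy∈I → removed-edge-is-bridge xy∈I (reach-sym (edges-sym (I - combine x y)) (path (inj₁ refl))))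
    , (λ yx∈I → removed-edge-is-bridge yx∈I (path (inj₂ refl))) ]′
    (edges-true⁻ {I} {x} {y} xy)
    where
    path : ∀ {e} → e ≡ combine x y ⊎ e ≡ combine y x → Reach (edges (I - e)) y x
    path {e} e-xy = walk-avoiding-e I x y e e-xy y (y′ ∷ ys) x≢ y≢ (λ ()) walk
    removed-edge-is-bridge : ∀ {a b} → combine a b ∈ I → ¬ Reach (edges (I - combine a b)) a b
    removed-edge-is-bridge {a} {b} ab∈I = independent⇒bridge (I - combine a b) (x∉p-x I (combine a b))
      (subst (λ A → n ∸ ω A ≡ ∣ A ∣) (sym (x∈p⇒[p-x]∪⁅x⁆≡p ab∈I)) indep)

  -- Each edge {u , v} of a symmetric E is recorded once, at the index combine u v with u < v.
  orientedEdges : EdgeSet n → Subset (n * n)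
  orientedEdges E = tabulate λ e → ⌊ source e <? target e ⌋ ∧ E (source e) (target e)

  lookup-orientedEdges : ∀ E u v → lookup (orientedEdges E) (combine u v) ≡ ⌊ u <? v ⌋ ∧ E u v
  lookup-orientedEdges E u v =
    trans (lookup∘tabulate _ (combine u v))
          (cong (λ (a , b) → ⌊ a <? b ⌋ ∧ E a b) (source-target-combine u v))

  combine∈orientedEdges⁻ : ∀ {E u v} → combine u v ∈ orientedEdges E → u <ᶠ v × E u v ≡ true
  combine∈orientedEdges⁻ {E} {u} {v} uv∈
    with ∧-true⁻ ⌊ u <? v ⌋ (trans (sym (lookup-orientedEdges E u v)) ([]=⇒lookup uv∈))
  ... | u<v , Euv = ⌊⌋-true⁻ (u <? v) u<v , Euv

  combine∈orientedEdges⁺ : ∀ {E u v} → u <ᶠ v → E u v ≡ true → combine u v ∈ orientedEdges E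
  combine∈orientedEdges⁺ {E} {u} {v} u<v Euv = lookup⇒[]= _ _
    (trans (lookup-orientedEdges E u v) (cong₂ _∧_ (⌊⌋-true⁺ (u <? v) u<v) Euv))

  ∈orientedEdges⁻ : ∀ {E e} → e ∈ orientedEdges E → E (source e) (target e) ≡ true
  ∈orientedEdges⁻ {E} {e} e∈ = proj₂ (∧-true⁻ ⌊ source e <? target e ⌋ (∈-tabulate⁻ e∈))

  orientedEdges-mono : ∀ {E E' e} → (E (source e) (target e) ≡ true → E' (source e) (target e) ≡ true) →
    e ∈ orientedEdges E → e ∈ orientedEdges E'
  orientedEdges-mono {E} {E'} {e} E⇒E' e∈ with ∧-true⁻ ⌊ source e <? target e ⌋ (∈-tabulate⁻ e∈)
  ... | u<v , Euv = ∈-tabulate⁺ (cong₂ _∧_ u<v (E⇒E' Euv))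

  orientedEdges-⊑ : ∀ {E} → IsSymmetric E → edges (orientedEdges E) ⊑ E
  orientedEdges-⊑ {E} sym-E u v =
    [ proj₂ ∘ combine∈orientedEdges⁻ , trans (sym-E u v) ∘ proj₂ ∘ combine∈orientedEdges⁻ ]′
    ∘ edges-true⁻ {orientedEdges E} {u} {v}

  ⊑-orientedEdges : ∀ {E} → IsSymmetric E → (∀ u → E u u ≡ false) → E ⊑ edges (orientedEdges E)
  ⊑-orientedEdges {E} sym-E irreflexive u v Euv with <-cmp u v
  ... | tri< u<v _ _ = edges-true⁺ _ u v (inj₁ (combine∈orientedEdges⁺ u<v Euv))
  ... | tri≈ _ refl _ = case trans (sym Euv) (irreflexive u) of λ ()
  ... | tri> _ _ v<u = edges-true⁺ _ u v (inj₂ (combine∈orientedEdges⁺ v<u (trans (sym-E v u) Euv)))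

  orientedEdges-edges-⊆ : ∀ {E I} → I ⊆ orientedEdges E → orientedEdges (edges I) ⊆ I
  orientedEdges-edges-⊆ {E} {I} I⊆ {e} e∈ =
    subst (_∈ I) (combine-remQuot {n} n e) ([ id , Empty-elim ∘ v≮u ]′ (edges-true⁻ {I} {u} {v} uv))
    where
    u = source e
    v = target e
    u<v = proj₁ (∧-true⁻ ⌊ u <? v ⌋ (∈-tabulate⁻ e∈))
    uv = proj₂ (∧-true⁻ ⌊ u <? v ⌋ (∈-tabulate⁻ e∈))
    v≮u : combine v u ∉ I
    v≮u vu∈I = <-asym (⌊⌋-true⁻ (u <? v) u<v) (proj₁ (combine∈orientedEdges⁻ {E} (I⊆ vu∈I)))

  module _ {E : EdgeSet n} (sym-E : IsSymmetric E) (irreflexive : ∀ u → E u u ≡ false) where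

    ω-orientedEdges : ∀ {j} → HasComponents E j → ω (orientedEdges E) ≡ j
    ω-orientedEdges = ω-unique (orientedEdges E) ∘
      components-cong (⊑-orientedEdges sym-E irreflexive) (orientedEdges-⊑ sym-E)

    components-ω-orientedEdges : HasComponents E (ω (orientedEdges E))
    components-ω-orientedEdges =
      components-cong (orientedEdges-⊑ sym-E) (⊑-orientedEdges sym-E irreflexive)
        (ω-components (orientedEdges E))

module _ {n k : ℕ} (G : ColoredGraph n k) where
  open CompleteGraph n

  edgeColour : Fin (n * n) → Fin k
  edgeColour e = color G (source e) (target e)

  countColor≡∣orientedEdges∩colourClass∣ : ∀ E c →
    countColor (color G) E c ≡ ∣ orientedEdges E ∩ colourClass edgeColour c ∣
  countColor≡∣orientedEdges∩colourClass∣ E c = sym (begin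
    ∣ O ∩ K ∣ ≡⟨ ∣p∣≡∑ (O ∩ K) ⟩
    ∑[ e < n * n ] ⟦ lookup (O ∩ K) e ⟧ ≡⟨ ∑-combine n n _ ⟩
    ∑[ u < n ] ∑[ v < n ] ⟦ lookup (O ∩ K) (combine u v) ⟧
      ≡⟨ sum-cong-≗ (λ u → sum-cong-≗ (cong ⟦_⟧ ∘ lookup-O∩K u)) ⟩
    ∑[ u < n ] ∑[ v < n ] ⟦ ⌊ u <? v ⌋ ∧ E u v ∧ ⌊ color G u v ≟ c ⌋ ⟧
      ≡⟨ trans (sum-map-allFin n _) (sum-cong-≗ {n} (λ u → sum-map-allFin n _)) ⟨
    countColor (color G) E c ∎)
    where
    open ≡-Reasoning
    O = orientedEdges E
    K = colourClass edgeColour c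
    lookup-O∩K : ∀ u v → lookup (O ∩ K) (combine u v) ≡ ⌊ u <? v ⌋ ∧ E u v ∧ ⌊ color G u v ≟ c ⌋
    lookup-O∩K u v = begin
      lookup (O ∩ K) (combine u v) ≡⟨ lookup-zipWith _∧_ (combine u v) O K ⟩
      lookup O (combine u v) ∧ lookup K (combine u v)
        ≡⟨ cong₂ _∧_ (lookup-orientedEdges E u v)
                     (trans (lookup∘tabulate _ (combine u v))
                            (cong (λ (a , b) → ⌊ color G a b ≟ c ⌋) (source-target-combine u v))) ⟩
      (⌊ u <? v ⌋ ∧ E u v) ∧ ⌊ color G u v ≟ c ⌋ ≡⟨ ∧-assoc ⌊ u <? v ⌋ (E u v) _ ⟩
      ⌊ u <? v ⌋ ∧ E u v ∧ ⌊ color G u v ≟ c ⌋ ∎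

  deleteColors-sym : ∀ R → IsSymmetric (deleteColors G R)
  deleteColors-sym R u v with adj G u v in uv
  ... | true = cong₂ (λ a c → a ∧ not ⌊ c ∈? R ⌋) (trans (sym uv) (adj-sym G u v)) (color-sym G u v uv)
  ... | false = cong (_∧ not ⌊ color G v u ∈? R ⌋) (trans (sym uv) (adj-sym G u v))

  deleteColors-irreflexive : ∀ R u → deleteColors G R u u ≡ false
  deleteColors-irreflexive R u = cong (_∧ not ⌊ color G u u ∈? R ⌋) (adj-irr G u)

  colouredIn : Subset k → Subset (n * n)
  colouredIn R = tabulate (λ e → ⌊ edgeColour e ∈? R ⌋)

  ∈colourClass⁻ : ∀ {e c} → e ∈ colourClass edgeColour c → edgeColour e ≡ c
  ∈colourClass⁻ {e} {c} = ⌊⌋-true⁻ (edgeColour e ≟ c) ∘ ∈-tabulate⁻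

  ∈colouredIn⁻ : ∀ {e R} → e ∈ colouredIn R → edgeColour e ∈ R
  ∈colouredIn⁻ {e} {R} = ⌊⌋-true⁻ (edgeColour e ∈? R) ∘ ∈-tabulate⁻

  ∉colouredIn⁻ : ∀ {e R} → e ∉ colouredIn R → ⌊ edgeColour e ∈? R ⌋ ≡ false
  ∉colouredIn⁻ e∉ = ¬-not (e∉ ∘ ∈-tabulate⁺)

  sumOver≡∑ : ∀ R (f : Fin k → ℕ) → sumOver R f ≡ ∑[ c < k ] (if ⌊ c ∈? R ⌋ then f c else 0)
  sumOver≡∑ R f = sum-map-allFin k _

  module _ (f : Fin k → ℕ) where
    private
      K = colourClass edgeColour

    forest⇒component-condition : ∀ {m} → HasChromaticForest G f m → ComponentCondition G f m
    forest⇒component-condition {m} (F , F-sym , F⊆adj , _ , F-components , F-chromatic) R j G-R-components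
      = begin
      j ≡⟨ ω-orientedEdges (deleteColors-sym R) (deleteColors-irreflexive R) G-R-components ⟨
      ω (orientedEdges (deleteColors G R)) ≤⟨ ω-antitone I∩∁C⊆D ⟩
      ω (I ∩ ∁ C) ≤⟨ ω[A]≤ω[A∪Z]+∣Z∣ (I ∩ ∁ C) (I ∩ C) ⟩
      ω ((I ∩ ∁ C) ∪ (I ∩ C)) + ∣ I ∩ C ∣ ≡⟨ cong (λ A → ω A + ∣ I ∩ C ∣) I∩∁C∪I∩C≡I ⟩
      ω I + ∣ I ∩ C ∣ ≡⟨ cong (_+ ∣ I ∩ C ∣) (ω-orientedEdges F-sym F-irreflexive F-components) ⟩
      m + ∣ I ∩ C ∣ ≤⟨ +-monoʳ-≤ m ∣I∩C∣≤sumOver ⟩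
      m + sumOver R f ∎
      where
      open ≤-Reasoning
      I = orientedEdges F
      C = colouredIn R

      F-irreflexive : ∀ u → F u u ≡ false
      F-irreflexive u = ¬-not λ Fuu → case trans (sym (F⊆adj u u Fuu)) (adj-irr G u) of λ ()

      I∩∁C⊆D : I ∩ ∁ C ⊆ orientedEdges (deleteColors G R)
      I∩∁C⊆D {e} e∈ with x∈p∩q⁻ I (∁ C) e∈
      ... | e∈I , e∈∁C = orientedEdges-mono {F} {deleteColors G R} (λ Fuv →
        cong₂ _∧_ (F⊆adj _ _ Fuv) (cong not (∉colouredIn⁻ (x∈∁p⇒x∉p e∈∁C)))) e∈I

      I∩∁C∪I∩C≡I : (I ∩ ∁ C) ∪ (I ∩ C) ≡ I
      I∩∁C∪I∩C≡I =
        trans (sym (∩-distribˡ-∪ I (∁ C) C)) (trans (cong (I ∩_) (∪-inverseˡ C)) (∩-identityʳ I))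

      I∩C∩K⊆⊥ : ∀ {c} → c ∉ R → (I ∩ C) ∩ K c ⊆ ⊥
      I∩C∩K⊆⊥ {c} c∉R e∈ with x∈p∩q⁻ (I ∩ C) (K c) e∈
      ... | e∈I∩C , e∈K =
        Empty-elim (c∉R (subst (_∈ R) (∈colourClass⁻ e∈K) (∈colouredIn⁻ (proj₂ (x∈p∩q⁻ I C e∈I∩C)))))

      per-colour : ∀ c → ∣ (I ∩ C) ∩ K c ∣ ≤ (if ⌊ c ∈? R ⌋ then f c else 0)
      per-colour c with c ∈? R
      ... | yes _ = begin
        ∣ (I ∩ C) ∩ K c ∣ ≤⟨ p⊆q⇒∣p∣≤∣q∣ (∩-monoˡ-⊆ (K c) (p∩q⊆p I C)) ⟩
        ∣ I ∩ K c ∣ ≡⟨ countColor≡∣orientedEdges∩colourClass∣ F c ⟨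
        countColor (color G) F c ≤⟨ F-chromatic c ⟩
        f c ∎
      ... | no c∉R = ≤-trans (p⊆q⇒∣p∣≤∣q∣ (I∩C∩K⊆⊥ c∉R)) (≤-reflexive (∣⊥∣≡0 (n * n)))

      ∣I∩C∣≤sumOver : ∣ I ∩ C ∣ ≤ sumOver R f
      ∣I∩C∣≤sumOver = begin
        ∣ I ∩ C ∣ ≡⟨ ∣p∣≡∑∣p∩colourClass∣ edgeColour (I ∩ C) ⟩
        ∑[ c < k ] ∣ (I ∩ C) ∩ K c ∣ ≤⟨ ∑-mono-≤ per-colour ⟩
        ∑[ c < k ] (if ⌊ c ∈? R ⌋ then f c else 0) ≡⟨ sumOver≡∑ R f ⟨
        sumOver R f ∎

    S₀ : Subset (n * n)
    S₀ = orientedEdges (adj G)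

    -- For W = S₀ ─ U let R be the colours saturated by W and Z the edges of W with other colours.
    -- U ∪ Z contains G − E_R(G), so ω U ≤ m + ∑_{c ∈ R} f c + ∣ Z ∣, and this sum is at most r₂ W.
    component-condition⇒rank-sum-bound : ∀ {m} → ComponentCondition G f m →
      RankSumBound graphicRank (partitionRank edgeColour f) S₀ (0 + 0 + (n ∸ m))
    component-condition⇒rank-sum-bound {m} condition U U⊆S₀ =
      ≤-trans (m∸n≤[m∸a]+x n {m} (sumOver R f + ∣ Z ∣) ωU≤) (+-monoʳ-≤ (n ∸ ω U) sumOver+∣Z∣≤rank₂W)
      where
      W = S₀ ─ U
      R : Subset k
      R = tabulate (λ c → ⌊ f c ≤? ∣ W ∩ K c ∣ ⌋)
      C = colouredIn R
      Z = W ∩ ∁ C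
      D = orientedEdges (deleteColors G R)

      D⊆U∪Z : D ⊆ U ∪ Z
      D⊆U∪Z {e} e∈D with e ∈? U
      ... | yes e∈U = x∈p∪q⁺ (inj₁ e∈U)
      ... | no e∉U = x∈p∪q⁺ (inj₂ (x∈p∩q⁺ (x∈p∧x∉q⇒x∈p─q e∈S₀ e∉U , x∉p⇒x∈∁p e∉C)))
        where
        adj∧∉R = ∧-true⁻ (adj G (source e) (target e))
        e∈S₀ : e ∈ S₀
        e∈S₀ = orientedEdges-mono {deleteColors G R} {adj G} (proj₁ ∘ adj∧∉R) e∈D
        e∉C : e ∉ C
        e∉C e∈C = case trans (sym (cong not (∈-tabulate⁻ e∈C)))
                             (proj₂ (adj∧∉R (∈orientedEdges⁻ {deleteColors G R} e∈D))) of λ ()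

      components-D : HasComponents (deleteColors G R) (ω D)
      components-D = components-ω-orientedEdges (deleteColors-sym R) (deleteColors-irreflexive R)

      ωU≤ : ω U ≤ m + (sumOver R f + ∣ Z ∣)
      ωU≤ = begin
        ω U ≤⟨ ω[A]≤ω[A∪Z]+∣Z∣ U Z ⟩
        ω (U ∪ Z) + ∣ Z ∣ ≤⟨ +-monoˡ-≤ ∣ Z ∣ (ω-antitone D⊆U∪Z) ⟩
        ω D + ∣ Z ∣ ≤⟨ +-monoˡ-≤ ∣ Z ∣ (condition R (ω D) components-D) ⟩
        m + sumOver R f + ∣ Z ∣ ≡⟨ +-assoc m (sumOver R f) ∣ Z ∣ ⟩
        m + (sumOver R f + ∣ Z ∣) ∎
        where open ≤-Reasoning

      f≤∣W∩K∣ : ∀ {c} → c ∈ R → f c ≤ ∣ W ∩ K c ∣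
      f≤∣W∩K∣ {c} = ⌊⌋-true⁻ (f c ≤? ∣ W ∩ K c ∣) ∘ ∈-tabulate⁻

      ∣W∩K∣<f : ∀ {c} → c ∉ R → ∣ W ∩ K c ∣ < f c
      ∣W∩K∣<f {c} c∉R = ≰⇒> (c∉R ∘ ∈-tabulate⁺ ∘ ⌊⌋-true⁺ (f c ≤? ∣ W ∩ K c ∣))

      Z∩K⊆⊥ : ∀ {c} → c ∈ R → Z ∩ K c ⊆ ⊥
      Z∩K⊆⊥ {c} c∈R {e} e∈ with x∈p∩q⁻ Z (K c) e∈
      ... | e∈Z , e∈K = Empty-elim (x∈∁p⇒x∉p (proj₂ (x∈p∩q⁻ W (∁ C) e∈Z))
        (∈-tabulate⁺ (⌊⌋-true⁺ (edgeColour e ∈? R) (subst (_∈ R) (sym (∈colourClass⁻ e∈K)) c∈R))))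

      per-colour : ∀ c → (if ⌊ c ∈? R ⌋ then f c else 0) + ∣ Z ∩ K c ∣ ≤ f c ⊓ ∣ W ∩ K c ∣
      per-colour c with c ∈? R
      ... | yes c∈R = begin
        f c + ∣ Z ∩ K c ∣ ≤⟨ +-monoʳ-≤ (f c) (p⊆q⇒∣p∣≤∣q∣ (Z∩K⊆⊥ c∈R)) ⟩
        f c + ∣ ⊥ {n = n * n} ∣ ≡⟨ cong (f c +_) (∣⊥∣≡0 (n * n)) ⟩
        f c + 0 ≡⟨ +-identityʳ (f c) ⟩
        f c ≡⟨ m≤n⇒m⊓n≡m (f≤∣W∩K∣ c∈R) ⟨
        f c ⊓ ∣ W ∩ K c ∣ ∎
        where open ≤-Reasoning
      ... | no c∉R = ⊓-glb (≤-trans ∣Z∩K∣≤∣W∩K∣ (<⇒≤ (∣W∩K∣<f c∉R))) ∣Z∩K∣≤∣W∩K∣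
        where
        ∣Z∩K∣≤∣W∩K∣ : ∣ Z ∩ K c ∣ ≤ ∣ W ∩ K c ∣
        ∣Z∩K∣≤∣W∩K∣ = p⊆q⇒∣p∣≤∣q∣ (∩-monoˡ-⊆ (K c) (p∩q⊆p W (∁ C)))

      sumOver+∣Z∣≤rank₂W : sumOver R f + ∣ Z ∣ ≤ rank (partitionRank edgeColour f) W
      sumOver+∣Z∣≤rank₂W = begin
        sumOver R f + ∣ Z ∣ ≡⟨ cong₂ _+_ (sumOver≡∑ R f) (∣p∣≡∑∣p∩colourClass∣ edgeColour Z) ⟩
        ∑[ c < k ] (if ⌊ c ∈? R ⌋ then f c else 0) + ∑[ c < k ] ∣ Z ∩ K c ∣
          ≡⟨ ∑-distrib-+ (λ c → if ⌊ c ∈? R ⌋ then f c else 0) _ ⟨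
        ∑[ c < k ] ((if ⌊ c ∈? R ⌋ then f c else 0) + ∣ Z ∩ K c ∣) ≤⟨ ∑-mono-≤ per-colour ⟩
        ∑[ c < k ] (f c ⊓ ∣ W ∩ K c ∣) ∎
        where open ≤-Reasoning

    component-condition⇒forest : ∀ {m} → m ≤ n → ComponentCondition G f m → HasChromaticForest G f m
    component-condition⇒forest {m} m≤n condition
      with matroid-intersection S₀ graphicRank (partitionRank edgeColour f) 0 (n ∸ m)
             (trans (cong (n ∸_) ω-⊥) (n∸n≡0 n)) (partitionRank-⊥ edgeColour f)
             (component-condition⇒rank-sum-bound condition)
    ... | I , I⊆S₀ , ∣I∣≡n∸m , rank₁I , rank₂I =
      edges I , edges-sym I , edges-I⊑adj , independent⇒acyclic I independent₁ ,
      subst (HasComponents (edges I)) ωI≡m (ω-components I) , chromatic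
      where
      independent₁ : n ∸ ω I ≡ ∣ I ∣
      independent₁ = trans rank₁I (trans (+-identityʳ (n ∸ m)) (sym ∣I∣≡n∸m))

      independent₂ : rank (partitionRank edgeColour f) I ≡ ∣ I ∣
      independent₂ = trans rank₂I (trans (+-identityʳ (n ∸ m)) (sym ∣I∣≡n∸m))

      ωI≡m : ω I ≡ m
      ωI≡m = ∸-cancelˡ-≡ (ω≤n I) m≤n (trans rank₁I (+-identityʳ (n ∸ m)))

      edges-I⊑adj : ∀ u v → edges I u v ≡ true → adj G u v ≡ true
      edges-I⊑adj u v = orientedEdges-⊑ (adj-sym G) u v ∘ edges-mono I⊆S₀ u v

      chromatic : ∀ c → countColor (color G) (edges I) c ≤ f c
      chromatic c = begin
        countColor (color G) (edges I) c ≡⟨ countColor≡∣orientedEdges∩colourClass∣ (edges I) c ⟩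
        ∣ orientedEdges (edges I) ∩ K c ∣
          ≤⟨ p⊆q⇒∣p∣≤∣q∣ (∩-monoˡ-⊆ (K c) (orientedEdges-edges-⊆ {adj G} I⊆S₀)) ⟩
        ∣ I ∩ K c ∣ ≤⟨ partition-independent⇒capacity edgeColour f I independent₂ c ⟩
        f c ∎
        where open ≤-Reasoning

theorem9 : (n k m : ℕ) → 1 ≤ m → m ≤ n →
  (G : ColoredGraph n k) (f : Fin k → ℕ) →
  HasChromaticForest G f m ⇔ ComponentCondition G f m
theorem9 n k m _ m≤n G f = mk⇔ (forest⇒component-condition G f) (component-condition⇒forest G f m≤n)
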